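{- Let $n\ge 1$. For $\mathbf{a}=(a_1,a_2)\in\mathbb{Z}_{\ge0}^2$ define the polynomial $\mathrm{Tr}_{n,\mathbf{a}}$ on $(\mathbb{C}^n)^2$, in the variables $x_{k,i}$ ($k=1,2$, $1\le i\le n$), by \[\mathrm{Tr}_{n,\mathbf{a}}(\mathbf{x}_1,\mathbf{x}_2)=\sum_{i=1}^n x_{1,i}^{a_1}x_{2,i}^{a_2},\] and let $D\mathrm{Tr}_{n,\mathbf{a}}=\left(\frac{\partial}{\partial x_{k,i}}\mathrm{Tr}_{n,\mathbf{a}}\right)_{k\in\{1,2\},\,1\le i\le n}$ be its row vector of $2n$ partial derivatives. Let $A_n=(\mathbf{a}_1,\dots,\mathbf{a}_{2n})$ consist of the first $2n$ elements of the sequence $(1,0),(0,1),(2,0),(1,1),(0,2),(3,0),\dots$, i.e. of all pairs $(i,j)\in\mathbb{Z}_{\ge0}^2\setminus\{(0,0)\}$ ordered first by total degree $i+j$ and then by increasing $j$. Then the determinant of the $2n\times 2n$ matrix whose rows are $D\mathrm{Tr}_{n,\mathbf{a}}$ for $\mathbf{a}\in A_n$ is not identically zero as a polynomial in the $x_{k,i}$. -}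

module Defs where

open import Data.Nat as ℕ using (ℕ; zero; suc; _∸_; _≡ᵇ_)
open import Data.Integer as ℤ using (ℤ; 0ℤ; 1ℤ; +_; -_)
open import Data.Fin as Fin using (Fin; toℕ; punchIn)
open import Data.Bool using (Bool; true; false; _∧_; if_then_else_)
open import Data.Product using (_×_; _,_; proj₁; proj₂)
open import Data.Vec.Functional using (_∷_)
open import Relation.Nullary using (does)

-- Formal polynomials with integer coefficients in m variables,
-- represented by their coefficient function on exponent vectors
-- (monomials) Fin m → ℕ.  Multiplication is the Cauchy product, which
-- only needs finitely many terms for each monomial.

Mon : ℕ → Set
Mon m = Fin m → ℕ

Poly : ℕ → Set
Poly m = Mon m → ℤ

eqMon : ∀ {m} → Mon m → Mon m → Bool
eqMon {zero}  e f = true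
eqMon {suc m} e f = (e Fin.zero ≡ᵇ f Fin.zero) ∧ eqMon (λ i → e (Fin.suc i)) (λ i → f (Fin.suc i))

unitMon : ∀ {m} → Fin m → Mon m
unitMon j i = if does (j Fin.≟ i) then 1 else 0

isEven : ℕ → Bool
isEven zero = true
isEven (suc k) = if isEven k then false else true

sumUpTo : ℕ → (ℕ → ℤ) → ℤ
sumUpTo zero    f = f 0
sumUpTo (suc N) f = sumUpTo N f ℤ.+ f (suc N)

boxSum : ∀ m → Mon m → (Mon m → ℤ) → ℤ
boxSum zero    e g = g (λ ())
boxSum (suc m) e g =
  sumUpTo (e Fin.zero) (λ k → boxSum m (λ i → e (Fin.suc i)) (λ d → g (k ∷ d)))

sumFin : ∀ {n} {A : Set} → (A → A → A) → A → (Fin n → A) → A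
sumFin {zero}  _+_ z f = z
sumFin {suc n} _+_ z f = f Fin.zero + sumFin _+_ z (λ i → f (Fin.suc i))

0P : ∀ {m} → Poly m
0P e = 0ℤ

1P : ∀ {m} → Poly m
1P e = if eqMon e (λ _ → 0) then 1ℤ else 0ℤ

X : ∀ {m} → Fin m → Poly m
X j e = if eqMon e (unitMon j) then 1ℤ else 0ℤ

_+P_ : ∀ {m} → Poly m → Poly m → Poly m
(p +P q) e = p e ℤ.+ q e

-P_ : ∀ {m} → Poly m → Poly m
(-P p) e = - p e

_*P_ : ∀ {m} → Poly m → Poly m → Poly m
_*P_ {m} p q e = boxSum m e (λ d → p d ℤ.* q (λ i → e i ∸ d i))

_^P_ : ∀ {m} → Poly m → ℕ → Poly m
p ^P zero  = 1P
p ^P suc k = p *P (p ^P k)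

sumP : ∀ {m n} → (Fin n → Poly m) → Poly m
sumP = sumFin _+P_ 0P

∂ : ∀ {m} → Fin m → Poly m → Poly m
∂ j p e = + suc (e j) ℤ.* p (λ i → e i ℕ.+ unitMon j i)

det : ∀ {m n} → (Fin n → Fin n → Poly m) → Poly m
det {m} {zero}  M = 1P
det {m} {suc n} M =
  sumP (λ j → sign j (M Fin.zero j *P det (λ r c → M (Fin.suc r) (punchIn j c))))
  where
  sign : Fin (suc n) → Poly m → Poly m
  sign j p = if isEven (toℕ j) then p else -P p

-- The specific objects of the statement.
-- Variables x_{k,i} (k ∈ {1,2}, 1 ≤ i ≤ n) are indexed by Fin (n + n):
-- x_{1,i} ↦ inject+ n i,  x_{2,i} ↦ raise n i.

x₁ : ∀ n → Fin n → Fin (n ℕ.+ n)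
x₁ n i = i Fin.↑ˡ n

x₂ : ∀ n → Fin n → Fin (n ℕ.+ n)
x₂ n i = n Fin.↑ʳ i

Tr : ∀ n → ℕ × ℕ → Poly (n ℕ.+ n)
Tr n (a₁ , a₂) = sumP (λ i → (X (x₁ n i) ^P a₁) *P (X (x₂ n i) ^P a₂))

nextPair : ℕ × ℕ → ℕ × ℕ
nextPair (suc i , j) = (i , suc j)
nextPair (zero  , j) = (suc j , 0)

seqA : ℕ → ℕ × ℕ
seqA zero    = (1 , 0)
seqA (suc k) = nextPair (seqA k)

-- the 2n × 2n matrix with rows D Tr_{n,a} for a ∈ A_n
-- (row r is D Tr_{n, a_{r+1}}, column c is ∂/∂(variable c))
Jac : ∀ n → Fin (n ℕ.+ n) → Fin (n ℕ.+ n) → Poly (n ℕ.+ n)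
Jac n r c = ∂ c (Tr n (seqA (toℕ r)))

{-# OPTIONS --safe #-}
module Submission where

-- Every entry ∂ Tr_{a_R} / ∂ x_{k,j} of the Jacobian matrix is a single
-- monomial.  Weight the variables (x_{1,i} by κ i · L, x_{2,i} by κ i · (L + 1),
-- with κ i = n − i and L = 2n) and give each row R a potential rowPot R and each
-- column v a potential colPot v with rowPot R ≤ wt m + colPot v for every
-- nonzero entry m.  Then the coefficient in det of a monomial e vanishes when
-- wt e + Σ colPot < Σ rowPot, and when equality holds only products of entries
-- attaining the bound contribute.  The potentials are chosen so that in rows 2s
-- and 2s+1 the bound is attained only in the columns x_{1,s}, x_{2,s} (columns of
-- smaller index being used by earlier rows).  For the monomial E of the product
-- of these 2 × 2 blocks the coefficient is therefore
-- ± ∏_s (a₁(2s) a₂(2s+1) − a₂(2s) a₁(2s+1)), and no factor vanishes because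
-- consecutive pairs of the sequence are not proportional.

open import Defs
open import Data.Bool using (Bool; true; false; not; if_then_else_)
import Data.Bool.Properties as BoolP
open import Data.Empty using (⊥-elim)
open import Data.Fin as Fin using (Fin; toℕ; punchIn)
import Data.Fin.Properties as FinP
open import Data.Integer as ℤ using (ℤ; 0ℤ; 1ℤ; -1ℤ; -_)
import Data.Integer.Properties as ℤP
import Data.Integer.Tactic.RingSolver as ℤSolver
open import Data.Nat as ℕ using (ℕ; zero; suc; _+_; _≤_; _<_; _∸_; z≤n; s≤s; _≡ᵇ_; ⌊_/2⌋)
import Data.Nat.Properties as ℕP
open import Algebra.Properties.CommutativeSemigroup ℕP.+-commutativeSemigroup
  using () renaming (interchange to +-interchange; x∙yz≈y∙xz to +-x∙yz≈y∙xz)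
open import Data.Nat.Tactic.RingSolver using (solve-∀)
open import Data.Product using (_×_; _,_; proj₁; proj₂; ∃; ∃-syntax)
open import Data.Product.Properties using (≡-dec)
open import Data.Sum using (_⊎_; inj₁; inj₂; [_,_]′)
open import Data.Vec.Functional using (_∷_)
open import Function using (_∘_)
open import Function.Definitions using (Congruent)
open import Relation.Binary.Definitions using (DecidableEquality; tri<; tri≈; tri>)
open import Relation.Binary.PropositionalEquality
open import Relation.Nullary using (does; Dec; yes; no; ¬_)
open import Relation.Nullary.Decidable using (dec-true; dec-false)

sumUpTo-cong : ∀ N {f g : ℕ → ℤ} → f ≗ g → sumUpTo N f ≡ sumUpTo N g
sumUpTo-cong zero    f≗g = f≗g 0
sumUpTo-cong (suc N) f≗g = cong₂ ℤ._+_ (sumUpTo-cong N f≗g) (f≗g (suc N))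

sumUpTo-zero : ∀ N (f : ℕ → ℤ) → (∀ k → k ≤ N → f k ≡ 0ℤ) → sumUpTo N f ≡ 0ℤ
sumUpTo-zero zero    f f≡0 = f≡0 0 z≤n
sumUpTo-zero (suc N) f f≡0
  rewrite sumUpTo-zero N f (λ k k≤N → f≡0 k (ℕP.m≤n⇒m≤1+n k≤N)) | f≡0 (suc N) ℕP.≤-refl = refl

sumUpTo-single : ∀ N (f : ℕ → ℤ) k₀ → k₀ ≤ N → (∀ k → k ≤ N → k ≢ k₀ → f k ≡ 0ℤ) →
                 sumUpTo N f ≡ f k₀
sumUpTo-single zero    f .0 z≤n f≡0 = refl
sumUpTo-single (suc N) f k₀ k₀≤ f≡0 with k₀ ℕ.≟ suc N
... | yes refl
  rewrite sumUpTo-zero N f (λ k k≤N → f≡0 k (ℕP.m≤n⇒m≤1+n k≤N) (ℕP.<⇒≢ (s≤s k≤N)))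
  = ℤP.+-identityˡ (f (suc N))
... | no k₀≢
  rewrite sumUpTo-single N f k₀ (ℕP.≤-pred (ℕP.≤∧≢⇒< k₀≤ k₀≢))
                         (λ k k≤N → f≡0 k (ℕP.m≤n⇒m≤1+n k≤N))
        | f≡0 (suc N) ℕP.≤-refl (k₀≢ ∘ sym) = ℤP.+-identityʳ (f k₀)

sumFin-cong : ∀ {n} {A : Set} (_∙_ : A → A → A) (ε : A) {F G : Fin n → A} →
              F ≗ G → sumFin _∙_ ε F ≡ sumFin _∙_ ε G
sumFin-cong {zero}  _∙_ ε F≗G = refl
sumFin-cong {suc n} _∙_ ε F≗G = cong₂ _∙_ (F≗G Fin.zero) (sumFin-cong _∙_ ε (F≗G ∘ Fin.suc))

module _ {A : Set} (_∙_ : A → A → A) (ε : A)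
         (identity : (∀ x → ε ∙ x ≡ x) × (∀ x → x ∙ ε ≡ x)) where

  sumFin-zero : ∀ {n} (F : Fin n → A) → (∀ j → F j ≡ ε) → sumFin _∙_ ε F ≡ ε
  sumFin-zero {zero}  F F≡ε = refl
  sumFin-zero {suc n} F F≡ε rewrite F≡ε Fin.zero =
    trans (proj₁ identity _) (sumFin-zero (F ∘ Fin.suc) (F≡ε ∘ Fin.suc))

  sumFin-single : ∀ {n} (F : Fin n → A) j₀ → (∀ j → j ≢ j₀ → F j ≡ ε) → sumFin _∙_ ε F ≡ F j₀
  sumFin-single {suc n} F Fin.zero F≡ε
    rewrite sumFin-zero (F ∘ Fin.suc) (λ j → F≡ε (Fin.suc j) λ ()) = proj₂ identity _
  sumFin-single {suc n} F (Fin.suc j₀) F≡ε rewrite F≡ε Fin.zero (λ ()) =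
    trans (proj₁ identity _)
          (sumFin-single (F ∘ Fin.suc) j₀ (λ j j≢ → F≡ε (Fin.suc j) (j≢ ∘ FinP.suc-injective)))

sumℤ : ∀ {n} → (Fin n → ℤ) → ℤ
sumℤ = sumFin ℤ._+_ 0ℤ

sumℕ : ∀ {n} → (Fin n → ℕ) → ℕ
sumℕ = sumFin ℕ._+_ 0

sumℕ-+ : ∀ {n} (F G : Fin n → ℕ) → sumℕ (λ i → F i + G i) ≡ sumℕ F + sumℕ G
sumℕ-+ {zero}  F G = refl
sumℕ-+ {suc n} F G rewrite sumℕ-+ (F ∘ Fin.suc) (G ∘ Fin.suc) = +-interchange (F Fin.zero) (G Fin.zero) _ _

sumℕ-punchIn : ∀ {n} (F : Fin (suc n) → ℕ) j → sumℕ F ≡ F j + sumℕ (F ∘ punchIn j)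
sumℕ-punchIn {n}     F Fin.zero    = refl
sumℕ-punchIn {suc n} F (Fin.suc j)
  rewrite sumℕ-punchIn (F ∘ Fin.suc) j = +-x∙yz≈y∙xz (F Fin.zero) (F (Fin.suc j)) _

toℕ-punchIn-< : ∀ {N} (i : Fin (suc N)) (c : Fin N) → toℕ c < toℕ i → toℕ (punchIn i c) ≡ toℕ c
toℕ-punchIn-< (Fin.suc i) Fin.zero    _         = refl
toℕ-punchIn-< (Fin.suc i) (Fin.suc c) (s≤s c<i) = cong suc (toℕ-punchIn-< i c c<i)

toℕ-punchIn-≥ : ∀ {N} (i : Fin (suc N)) (c : Fin N) → toℕ i ≤ toℕ c → toℕ (punchIn i c) ≡ suc (toℕ c)
toℕ-punchIn-≥ Fin.zero    c           _         = refl
toℕ-punchIn-≥ (Fin.suc i) (Fin.suc c) (s≤s i≤c) = cong suc (toℕ-punchIn-≥ i c i≤c)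

sumℕ-++ : ∀ a b (F : Fin (a + b) → ℕ) →
          sumℕ F ≡ sumℕ (λ i → F (i Fin.↑ˡ b)) + sumℕ (λ i → F (a Fin.↑ʳ i))
sumℕ-++ zero    b F = refl
sumℕ-++ (suc a) b F rewrite sumℕ-++ a b (F ∘ Fin.suc) = sym (ℕP.+-assoc (F Fin.zero) _ _)

sumℤ-*-distribˡ : ∀ {n} c (F : Fin n → ℤ) → c ℤ.* sumℤ F ≡ sumℤ (λ i → c ℤ.* F i)
sumℤ-*-distribˡ {zero}  c F = ℤP.*-zeroʳ c
sumℤ-*-distribˡ {suc n} c F =
  trans (ℤP.*-distribˡ-+ c (F Fin.zero) _) (cong (λ s → c ℤ.* F Fin.zero ℤ.+ s) (sumℤ-*-distribˡ c (F ∘ Fin.suc)))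

module _ {m : ℕ} where

  infix 4 _≤ₘ_
  _≤ₘ_ : Mon m → Mon m → Set
  d ≤ₘ e = ∀ i → d i ≤ e i

  _≤ₘ?_ : (d e : Mon m) → Dec (d ≤ₘ e)
  d ≤ₘ? e = FinP.all? (λ i → d i ℕ.≤? e i)

  _≗?_ : (d e : Mon m) → Dec (d ≗ e)
  d ≗? e = FinP.all? (λ i → d i ℕ.≟ e i)

  _+ₘ_ _∸ₘ_ : Mon m → Mon m → Mon m
  (d +ₘ e) i = d i + e i
  (d ∸ₘ e) i = d i ∸ e i

  0ₘ : Mon m
  0ₘ i = 0

  monomial : ℤ → Mon m → Poly m
  monomial c d e = if does (e ≗? d) then c else 0ℤ

  record IsMonomial (c : ℤ) (d : Mon m) (p : Poly m) : Set where
    field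
      at  : ∀ e → e ≗ d → p e ≡ c
      off : ∀ e → ¬ e ≗ d → p e ≡ 0ℤ

  open IsMonomial public

  monomial-isMonomial : ∀ c d → IsMonomial c d (monomial c d)
  monomial-isMonomial c d = record
    { at  = λ e e≗d → cong (if_then c else 0ℤ) (dec-true (e ≗? d) e≗d)
    ; off = λ e e≭d → cong (if_then c else 0ℤ) (dec-false (e ≗? d) e≭d)
    }

  isMonomial-congruent : ∀ {c d p} → IsMonomial c d p → Congruent _≗_ _≡_ p
  isMonomial-congruent {d = d} M {e} {e′} e≗e′ with e ≗? d
  ... | yes e≗d = trans (at M e e≗d) (sym (at M e′ (λ i → trans (sym (e≗e′ i)) (e≗d i))))
  ... | no  e≭d = trans (off M e e≭d) (sym (off M e′ (λ e′≗d → e≭d (λ i → trans (e≗e′ i) (e′≗d i)))))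

  isMonomial-unique : ∀ {c d p c′ d′ p′} → IsMonomial c d p → IsMonomial c′ d′ p′ →
                      c ≡ c′ → d ≗ d′ → p ≗ p′
  isMonomial-unique {d = d} M M′ refl d≗d′ e with e ≗? d
  ... | yes e≗d = trans (at M e e≗d) (sym (at M′ e (λ i → trans (e≗d i) (d≗d′ i))))
  ... | no  e≭d = trans (off M e e≭d)
                        (sym (off M′ e (λ e≗d′ → e≭d (λ i → trans (e≗d′ i) (sym (d≗d′ i))))))

  isMonomial-resp : ∀ {c c′ d d′ p p′} → c ≡ c′ → d ≗ d′ → p ≗ p′ →
                    IsMonomial c d p → IsMonomial c′ d′ p′
  isMonomial-resp refl d≗d′ p≗p′ M = record
    { at  = λ e e≗d′ → trans (sym (p≗p′ e)) (at M e λ i → trans (e≗d′ i) (sym (d≗d′ i)))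
    ; off = λ e e≭d′ → trans (sym (p≗p′ e)) (off M e λ e≗d → e≭d′ λ i → trans (e≗d i) (d≗d′ i))
    }

  isMonomial-zero : ∀ {d p} → IsMonomial 0ℤ d p → ∀ e → p e ≡ 0ℤ
  isMonomial-zero {d} M e with e ≗? d
  ... | yes e≗d = at M e e≗d
  ... | no  e≭d = off M e e≭d

eqMon-≗ : ∀ {m} (d e : Mon m) → d ≗ e → eqMon d e ≡ true
eqMon-≗ {zero}  d e d≗e = refl
eqMon-≗ {suc m} d e d≗e rewrite dec-true (d Fin.zero ℕ.≟ e Fin.zero) (d≗e Fin.zero) =
  eqMon-≗ (d ∘ Fin.suc) (e ∘ Fin.suc) (d≗e ∘ Fin.suc)

eqMon-≭ : ∀ {m} (d e : Mon m) → ¬ d ≗ e → eqMon d e ≡ false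
eqMon-≭ {zero}  d e d≭e = ⊥-elim (d≭e λ ())
eqMon-≭ {suc m} d e d≭e with d Fin.zero ℕ.≟ e Fin.zero
... | no  d₀≢e₀ rewrite dec-false (d Fin.zero ℕ.≟ e Fin.zero) d₀≢e₀ = refl
... | yes d₀≡e₀ rewrite dec-true (d Fin.zero ℕ.≟ e Fin.zero) d₀≡e₀ = eqMon-≭ (d ∘ Fin.suc) (e ∘ Fin.suc)
                    (λ d≗e → d≭e λ { Fin.zero → d₀≡e₀ ; (Fin.suc i) → d≗e i })

eqMon-isMonomial : ∀ {m} c (d : Mon m) → IsMonomial c d (λ e → if eqMon e d then c else 0ℤ)
eqMon-isMonomial c d = record
  { at  = λ e e≗d → cong (if_then c else 0ℤ) (eqMon-≗ e d e≗d)
  ; off = λ e e≭d → cong (if_then c else 0ℤ) (eqMon-≭ e d e≭d)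
  }

1P-isMonomial : ∀ {m} → IsMonomial {m} 1ℤ 0ₘ 1P
1P-isMonomial = eqMon-isMonomial 1ℤ 0ₘ

X-isMonomial : ∀ {m} (j : Fin m) → IsMonomial 1ℤ (unitMon j) (X j)
X-isMonomial j = eqMon-isMonomial 1ℤ (unitMon j)

boxSum-cong : ∀ m {e e′ : Mon m} {g g′ : Mon m → ℤ} → e ≗ e′ → g ≗ g′ →
              boxSum m e g ≡ boxSum m e′ g′
boxSum-cong zero    e≗e′ g≗g′ = g≗g′ _
boxSum-cong (suc m) {e} {e′} {g} e≗e′ g≗g′ =
  trans (cong (λ N → sumUpTo N (λ k → boxSum m (e ∘ Fin.suc) (λ d → g (k ∷ d)))) (e≗e′ Fin.zero))
        (sumUpTo-cong (e′ Fin.zero) (λ k → boxSum-cong m (e≗e′ ∘ Fin.suc) (λ d → g≗g′ (k ∷ d))))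

boxSum-zero : ∀ m (e : Mon m) (g : Mon m → ℤ) → (∀ d → d ≤ₘ e → g d ≡ 0ℤ) → boxSum m e g ≡ 0ℤ
boxSum-zero zero    e g g≡0 = g≡0 _ λ ()
boxSum-zero (suc m) e g g≡0 =
  sumUpTo-zero (e Fin.zero) _ λ k k≤ → boxSum-zero m _ _ λ d d≤ →
    g≡0 (k ∷ d) λ { Fin.zero → k≤ ; (Fin.suc i) → d≤ i }

boxSum-single : ∀ m (e : Mon m) (g : Mon m → ℤ) (d₀ : Mon m) → d₀ ≤ₘ e →
  (∀ d → d ≤ₘ e → ¬ d ≗ d₀ → g d ≡ 0ℤ) → Congruent _≗_ _≡_ g → boxSum m e g ≡ g d₀
boxSum-single zero    e g d₀ d₀≤e g≡0 g-cong = g-cong λ ()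
boxSum-single (suc m) e g d₀ d₀≤e g≡0 g-cong =
  trans (sumUpTo-single (e Fin.zero) _ (d₀ Fin.zero) (d₀≤e Fin.zero) λ k k≤ k≢ →
           boxSum-zero m _ _ λ d d≤ → g≡0 (k ∷ d) (λ { Fin.zero → k≤ ; (Fin.suc i) → d≤ i })
                                                 (λ k∷d≗d₀ → k≢ (k∷d≗d₀ Fin.zero)))
        (trans (boxSum-single m _ _ (d₀ ∘ Fin.suc) (d₀≤e ∘ Fin.suc)
                  (λ d d≤ d≭ → g≡0 _ (λ { Fin.zero → d₀≤e Fin.zero ; (Fin.suc i) → d≤ i })
                                       (λ ≗d₀ → d≭ (≗d₀ ∘ Fin.suc)))
                  (λ d≗d′ → g-cong λ { Fin.zero → refl ; (Fin.suc i) → d≗d′ i }))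
               (g-cong λ { Fin.zero → refl ; (Fin.suc i) → refl }))

module _ {m : ℕ} where

  *P-congruent : ∀ (p q : Poly m) → Congruent _≗_ _≡_ q → Congruent _≗_ _≡_ (p *P q)
  *P-congruent p q q-cong e≗e′ =
    boxSum-cong m e≗e′ λ d → cong (p d ℤ.*_) (q-cong λ i → cong (_∸ d i) (e≗e′ i))

  *P-cong : ∀ {p p′ q q′ : Poly m} → p ≗ p′ → q ≗ q′ → p *P q ≗ p′ *P q′
  *P-cong p≗p′ q≗q′ e = boxSum-cong m (λ _ → refl) λ d → cong₂ ℤ._*_ (p≗p′ d) (q≗q′ _)

  *P-zeroˡ : ∀ {p : Poly m} → (∀ e → p e ≡ 0ℤ) → ∀ q e → (p *P q) e ≡ 0ℤ
  *P-zeroˡ p≡0 q e = boxSum-zero m e _ λ d _ → cong (ℤ._* _) (p≡0 d)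

  module _ {c : ℤ} {d : Mon m} {p : Poly m} (p-mon : IsMonomial c d p) (q : Poly m) where

    *P-monomialˡ-≤ : Congruent _≗_ _≡_ q → ∀ e → d ≤ₘ e → (p *P q) e ≡ c ℤ.* q (e ∸ₘ d)
    *P-monomialˡ-≤ q-cong e d≤e =
      trans (boxSum-single m e _ d d≤e (λ d′ _ d′≭d → cong (ℤ._* _) (off p-mon d′ d′≭d))
               (λ d≗d′ → cong₂ ℤ._*_ (isMonomial-congruent p-mon d≗d′)
                                      (q-cong λ i → cong (e i ∸_) (d≗d′ i))))
            (cong (ℤ._* q (e ∸ₘ d)) (at p-mon d λ _ → refl))

    *P-monomialˡ-≰ : ∀ e → ¬ d ≤ₘ e → (p *P q) e ≡ 0ℤ
    *P-monomialˡ-≰ e d≰e = boxSum-zero m e _ λ d′ d′≤e → vanish d′ d′≤e (d′ ≗? d)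
      where
      vanish : ∀ d′ → d′ ≤ₘ e → Dec (d′ ≗ d) → p d′ ℤ.* q (e ∸ₘ d′) ≡ 0ℤ
      vanish d′ d′≤e (yes d′≗d) = ⊥-elim (d≰e λ i → subst (_≤ e i) (d′≗d i) (d′≤e i))
      vanish d′ d′≤e (no  d′≭d) = cong (ℤ._* _) (off p-mon d′ d′≭d)

    *P-monomialˡ : Congruent _≗_ _≡_ q → ∀ e z → (c ≢ 0ℤ → d ≤ₘ e × q (e ∸ₘ d) ≡ z) →
                   (p *P q) e ≡ c ℤ.* z
    *P-monomialˡ q-cong e z reduce with c ℤ.≟ 0ℤ
    ... | yes refl = *P-zeroˡ (isMonomial-zero p-mon) q e
    ... | no  c≢0  = let d≤e , q≡z = reduce c≢0 in
                     trans (*P-monomialˡ-≤ q-cong e d≤e) (cong (c ℤ.*_) q≡z)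

  *P-isMonomial : ∀ {c₁ c₂ d₁ d₂} {p q : Poly m} → IsMonomial c₁ d₁ p → IsMonomial c₂ d₂ q →
                  IsMonomial (c₁ ℤ.* c₂) (d₁ +ₘ d₂) (p *P q)
  *P-isMonomial {c₁} {c₂} {d₁} {d₂} {p} {q} p-mon q-mon = record { at = at′ ; off = off′ }
    where
    q-cong = isMonomial-congruent q-mon
    at′ : ∀ e → e ≗ d₁ +ₘ d₂ → (p *P q) e ≡ c₁ ℤ.* c₂
    at′ e e≗ = trans (*P-monomialˡ-≤ p-mon q q-cong e λ i → subst (d₁ i ≤_) (sym (e≗ i)) (ℕP.m≤m+n _ _))
                     (cong (c₁ ℤ.*_) (at q-mon _ λ i →
                        trans (cong (_∸ d₁ i) (e≗ i)) (ℕP.m+n∸m≡n (d₁ i) (d₂ i))))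
    off′ : ∀ e → ¬ e ≗ d₁ +ₘ d₂ → (p *P q) e ≡ 0ℤ
    off′ e e≭ with d₁ ≤ₘ? e
    ... | no  d₁≰e = *P-monomialˡ-≰ p-mon q e d₁≰e
    ... | yes d₁≤e = trans (*P-monomialˡ-≤ p-mon q q-cong e d₁≤e)
                           (trans (cong (c₁ ℤ.*_) (off q-mon _ λ e∸d₁≗d₂ →
                                     e≭ λ i → trans (sym (ℕP.m+[n∸m]≡n (d₁≤e i)))
                                                    (cong (d₁ i +_) (e∸d₁≗d₂ i))))
                                  (ℤP.*-zeroʳ c₁))

X^P-isMonomial : ∀ {m} (u : Fin m) k → IsMonomial 1ℤ (λ t → k ℕ.* unitMon u t) (X u ^P k)
X^P-isMonomial u zero    = 1P-isMonomial
X^P-isMonomial u (suc k) = *P-isMonomial (X-isMonomial u) (X^P-isMonomial u k)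

sumP-eval : ∀ {m n} (F : Fin n → Poly m) e → sumP F e ≡ sumℤ (λ j → F j e)
sumP-eval {n = zero}  F e = refl
sumP-eval {n = suc n} F e = cong (λ s → F Fin.zero e ℤ.+ s) (sumP-eval (F ∘ Fin.suc) e)

sumP-isMonomial : ∀ {m n c d} (F : Fin n → Poly m) J → IsMonomial c d (F J) →
                  (∀ j → j ≢ J → ∀ e → F j e ≡ 0ℤ) → IsMonomial c d (sumP F)
sumP-isMonomial F J F-mon F≡0 = record
  { at  = λ e e≗d → trans (single e) (at F-mon e e≗d)
  ; off = λ e e≭d → trans (single e) (off F-mon e e≭d)
  }
  where
  single : ∀ e → sumP F e ≡ F J e
  single e = trans (sumP-eval F e) (sumFin-single ℤ._+_ 0ℤ ℤP.+-identity _ J λ j j≢J → F≡0 j j≢J e)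

unitMon-diag : ∀ {m} (j : Fin m) → unitMon j j ≡ 1
unitMon-diag j rewrite dec-true (j Fin.≟ j) refl = refl

unitMon-≤ : ∀ {m} (j : Fin m) (d : Mon m) → 1 ≤ d j → unitMon j ≤ₘ d
unitMon-≤ j d 1≤dⱼ i with j Fin.≟ i
... | yes refl = 1≤dⱼ
... | no  _    = z≤n

∂-sumP : ∀ {m n} j (F : Fin n → Poly m) → ∂ j (sumP F) ≗ sumP (λ i → ∂ j (F i))
∂-sumP j F e = begin
  ℤ.+ suc (e j) ℤ.* sumP F e′               ≡⟨ cong (ℤ.+ suc (e j) ℤ.*_) (sumP-eval F e′) ⟩
  ℤ.+ suc (e j) ℤ.* sumℤ (λ i → F i e′)     ≡⟨ sumℤ-*-distribˡ (ℤ.+ suc (e j)) (λ i → F i e′) ⟩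
  sumℤ (λ i → ℤ.+ suc (e j) ℤ.* F i e′)     ≡⟨ sumP-eval (λ i → ∂ j (F i)) e ⟨
  sumP (λ i → ∂ j (F i)) e                  ∎
  where
  open ≡-Reasoning
  e′ = λ i → e i + unitMon j i

-- For d j = 0 both sides are the zero polynomial: the coefficient is c · 0.
∂-isMonomial : ∀ {m c d} {p : Poly m} j → IsMonomial c d p →
               IsMonomial (c ℤ.* ℤ.+ d j) (d ∸ₘ unitMon j) (∂ j p)
∂-isMonomial {m} {c} {d} {p} j p-mon = record { at = at′ ; off = off′ }
  where
  shift : Mon m → Mon m
  shift e i = e i + unitMon j i

  off′ : ∀ e → ¬ e ≗ d ∸ₘ unitMon j → ∂ j p e ≡ 0ℤ
  off′ e e≭ = trans (cong (ℤ.+ suc (e j) ℤ.*_) (off p-mon (shift e) λ shift≗d →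
                       e≭ λ i → trans (sym (ℕP.m+n∸n≡m (e i) (unitMon j i))) (cong (_∸ unitMon j i) (shift≗d i))))
                    (ℤP.*-zeroʳ (ℤ.+ suc (e j)))

  at′ : ∀ e → e ≗ d ∸ₘ unitMon j → ∂ j p e ≡ c ℤ.* ℤ.+ d j
  at′ e e≗ with d j in dⱼ≡
  ... | zero  = trans (cong (ℤ.+ suc (e j) ℤ.*_) (off p-mon (shift e) shift≭d))
                      (trans (ℤP.*-zeroʳ (ℤ.+ suc (e j))) (sym (ℤP.*-zeroʳ c)))
    where
    shift≭d : ¬ shift e ≗ d
    shift≭d shift≗d = ℕP.1+n≢0 (begin
      suc (e j)             ≡⟨ ℕP.+-comm 1 (e j) ⟩
      e j + 1               ≡⟨ cong (e j +_) (unitMon-diag j) ⟨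
      shift e j             ≡⟨ shift≗d j ⟩
      d j                   ≡⟨ dⱼ≡ ⟩
      0                     ∎)
      where open ≡-Reasoning
  ... | suc k = begin
    ℤ.+ suc (e j) ℤ.* p (shift e)
      ≡⟨ cong₂ (λ x y → ℤ.+ suc x ℤ.* y) eⱼ≡k (at p-mon (shift e) shift≗d) ⟩
    ℤ.+ suc k ℤ.* c
      ≡⟨ ℤP.*-comm (ℤ.+ suc k) c ⟩
    c ℤ.* ℤ.+ suc k ∎
    where
    open ≡-Reasoning
    eⱼ≡k : e j ≡ k
    eⱼ≡k rewrite e≗ j | dⱼ≡ | unitMon-diag j = refl
    shift≗d : shift e ≗ d
    shift≗d i = trans (cong (_+ unitMon j i) (e≗ i))
                      (ℕP.m∸n+n≡m (unitMon-≤ j d (subst (1 ≤_) (sym dⱼ≡) (s≤s z≤n)) i))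

+≢0⇒1≤ : ∀ {x} → ℤ.+ x ≢ 0ℤ → 1 ≤ x
+≢0⇒1≤ {zero}  +x≢0 = ⊥-elim (+x≢0 refl)
+≢0⇒1≤ {suc x} _    = s≤s z≤n

i*j≢0 : ∀ {i j} → i ≢ 0ℤ → j ≢ 0ℤ → i ℤ.* j ≢ 0ℤ
i*j≢0 {i} i≢0 j≢0 i*j≡0 = [ i≢0 , j≢0 ]′ (ℤP.i*j≡0⇒i≡0∨j≡0 i i*j≡0)

sign : ℕ → ℤ
sign k = if isEven k then 1ℤ else -1ℤ

sign-suc : ∀ k → sign (suc k) ≡ - sign k
sign-suc k with isEven k
... | true  = refl
... | false = refl

sign≢0 : ∀ k → sign k ≢ 0ℤ
sign≢0 k with isEven k
... | true  = λ ()
... | false = λ ()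

-- Laplace expansion

module _ {m : ℕ} where

  Matrix : ℕ → Set
  Matrix N = Fin N → Fin N → Poly m

  minor : ∀ {N} → Matrix (suc N) → Fin (suc N) → Matrix N
  minor M j r c = M (Fin.suc r) (punchIn j c)

  laplaceTerm : ∀ {N} → Matrix (suc N) → Fin (suc N) → Poly m
  laplaceTerm M j = M Fin.zero j *P det (minor M j)

  det-expand : ∀ {N} (M : Matrix (suc N)) e → det M e ≡ sumℤ (λ j → sign (toℕ j) ℤ.* laplaceTerm M j e)
  det-expand M e =
    trans (sumP-eval (λ j → if isEven (toℕ j) then laplaceTerm M j else -P laplaceTerm M j) e)
          (sumFin-cong ℤ._+_ 0ℤ λ j → signed (isEven (toℕ j)) (laplaceTerm M j))
    where
    signed : ∀ b (p : Poly m) → (if b then p else -P p) e ≡ (if b then 1ℤ else -1ℤ) ℤ.* p e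
    signed true  p = sym (ℤP.*-identityˡ (p e))
    signed false p = sym (ℤP.-1*i≡-i (p e))

  det-cong : ∀ {N} {M M′ : Matrix N} → (∀ r c → M r c ≗ M′ r c) → det M ≗ det M′
  det-cong {zero}  M≗M′ e = refl
  det-cong {suc N} {M} {M′} M≗M′ e = begin
    det M e
      ≡⟨ det-expand M e ⟩
    sumℤ (λ j → sign (toℕ j) ℤ.* laplaceTerm M j e)
      ≡⟨ sumFin-cong ℤ._+_ 0ℤ (λ j → cong (sign (toℕ j) ℤ.*_) (term≗ j)) ⟩
    sumℤ (λ j → sign (toℕ j) ℤ.* laplaceTerm M′ j e)
      ≡⟨ det-expand M′ e ⟨
    det M′ e ∎
    where
    open ≡-Reasoning
    term≗ : ∀ j → laplaceTerm M j e ≡ laplaceTerm M′ j e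
    term≗ j = *P-cong (M≗M′ Fin.zero j) (det-cong λ r c → M≗M′ (Fin.suc r) (punchIn j c)) e

  det-congruent : ∀ {N} (M : Matrix N) → (∀ r c → Congruent _≗_ _≡_ (M r c)) → Congruent _≗_ _≡_ (det M)
  det-congruent {zero}  M M-cong = isMonomial-congruent 1P-isMonomial
  det-congruent {suc N} M M-cong {e} {e′} e≗e′ = begin
    det M e
      ≡⟨ det-expand M e ⟩
    sumℤ (λ j → sign (toℕ j) ℤ.* laplaceTerm M j e)
      ≡⟨ sumFin-cong ℤ._+_ 0ℤ (λ j → cong (sign (toℕ j) ℤ.*_) (term≡ j)) ⟩
    sumℤ (λ j → sign (toℕ j) ℤ.* laplaceTerm M j e′)
      ≡⟨ det-expand M e′ ⟨
    det M e′ ∎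
    where
    open ≡-Reasoning
    term≡ : ∀ j → laplaceTerm M j e ≡ laplaceTerm M j e′
    term≡ j = *P-congruent (M Fin.zero j) _ (det-congruent (minor M j) λ r c → M-cong (Fin.suc r) (punchIn j c)) e≗e′

  det-cast : ∀ {N N′} (eq : N ≡ N′) (M : Matrix N) →
             det M ≗ det {n = N′} (λ r c → M (Fin.cast (sym eq) r) (Fin.cast (sym eq) c))
  det-cast refl M = det-cong λ r c e →
    sym (cong₂ (λ r′ c′ → M r′ c′ e) (FinP.cast-is-id refl r) (FinP.cast-is-id refl c))

  det-single-term : ∀ {N} (M : Matrix (suc N)) e j₀ → (∀ j → j ≢ j₀ → laplaceTerm M j e ≡ 0ℤ) →
                    det M e ≡ sign (toℕ j₀) ℤ.* laplaceTerm M j₀ e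
  det-single-term M e j₀ others≡0 = trans (det-expand M e) (sumFin-single ℤ._+_ 0ℤ ℤP.+-identity
    (λ j → sign (toℕ j) ℤ.* laplaceTerm M j e) j₀ λ j j≢j₀ →
    trans (cong (sign (toℕ j) ℤ.*_) (others≡0 j j≢j₀)) (ℤP.*-zeroʳ (sign (toℕ j))))

  det-two-terms : ∀ {N} (M : Matrix (suc (suc N))) e (p : Fin (suc N)) →
    (∀ j → j ≢ Fin.zero → j ≢ Fin.suc p → laplaceTerm M j e ≡ 0ℤ) →
    det M e ≡ laplaceTerm M Fin.zero e ℤ.+ sign (suc (toℕ p)) ℤ.* laplaceTerm M (Fin.suc p) e
  det-two-terms M e p others≡0 = trans (det-expand M e) (cong₂ ℤ._+_ (ℤP.*-identityˡ (laplaceTerm M Fin.zero e))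
    (sumFin-single ℤ._+_ 0ℤ ℤP.+-identity (λ j → sign (suc (toℕ j)) ℤ.* laplaceTerm M (Fin.suc j) e) p λ j j≢p →
      trans (cong (sign (suc (toℕ j)) ℤ.*_) (others≡0 (Fin.suc j) (λ ()) (j≢p ∘ FinP.suc-injective)))
            (ℤP.*-zeroʳ (sign (suc (toℕ j))))))

≗+ₘ-peel : ∀ {m} {e d₁ d₂ e′ : Mon m} → e ≗ d₁ +ₘ (d₂ +ₘ e′) →
           d₁ ≤ₘ e × d₂ ≤ₘ e ∸ₘ d₁ × (e ∸ₘ d₁) ∸ₘ d₂ ≗ e′
≗+ₘ-peel {d₁ = d₁} {d₂} {e′} e≗ =
  (λ i → subst (d₁ i ≤_) (sym (e≗ i)) (ℕP.m≤m+n _ _)) ,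
  (λ i → subst (d₂ i ≤_) (sym (e∸d₁≗ i)) (ℕP.m≤m+n _ _)) ,
  (λ i → trans (cong (_∸ d₂ i) (e∸d₁≗ i)) (ℕP.m+n∸m≡n (d₂ i) (e′ i)))
  where
  e∸d₁≗ = λ i → trans (cong (_∸ d₁ i) (e≗ i)) (ℕP.m+n∸m≡n (d₁ i) _)

laplaceTerm-twoStep : ∀ {m N} (M : Matrix {m} (suc (suc N))) j₁ j₂ {c₁ c₂ d₁ d₂} e Y →
  IsMonomial c₁ d₁ (M Fin.zero j₁) → IsMonomial c₂ d₂ (minor M j₁ Fin.zero j₂) →
  (∀ r c → Congruent _≗_ _≡_ (M r c)) →
  (c₁ ≢ 0ℤ → d₁ ≤ₘ e → ∀ j → j ≢ j₂ → laplaceTerm (minor M j₁) j (e ∸ₘ d₁) ≡ 0ℤ) →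
  (c₁ ≢ 0ℤ → c₂ ≢ 0ℤ →
    d₁ ≤ₘ e × d₂ ≤ₘ e ∸ₘ d₁ × det (minor (minor M j₁) j₂) ((e ∸ₘ d₁) ∸ₘ d₂) ≡ Y) →
  laplaceTerm M j₁ e ≡ c₁ ℤ.* (sign (toℕ j₂) ℤ.* (c₂ ℤ.* Y))
laplaceTerm-twoStep M j₁ j₂ {c₁} {c₂} {d₁} e Y mon₁ mon₂ M-cong others inner
  with c₁ ℤ.≟ 0ℤ | d₁ ≤ₘ? e
... | yes refl  | _        = *P-zeroˡ (isMonomial-zero mon₁) (det (minor M j₁)) e
... | no  c₁≢0 | yes d₁≤e =
  trans (*P-monomialˡ-≤ mon₁ (det M₁) (det-congruent M₁ λ r c → M-cong (Fin.suc r) (punchIn j₁ c)) e d₁≤e)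
  (cong (c₁ ℤ.*_) (trans (det-single-term M₁ (e ∸ₘ d₁) j₂ (others c₁≢0 d₁≤e))
    (cong (sign (toℕ j₂) ℤ.*_) (*P-monomialˡ mon₂ (det (minor M₁ j₂))
      (det-congruent (minor M₁ j₂) λ r c → M-cong (Fin.suc (Fin.suc r)) (punchIn j₁ (punchIn j₂ c))) (e ∸ₘ d₁) Y
      λ c₂≢0 → proj₂ (inner c₁≢0 c₂≢0)))))
  where M₁ = minor M j₁
... | no  c₁≢0 | no  d₁≰e with c₂ ℤ.≟ 0ℤ
...   | no  c₂≢0 = ⊥-elim (d₁≰e (proj₁ (inner c₁≢0 c₂≢0)))
...   | yes refl  = trans (*P-monomialˡ-≰ mon₁ (det (minor M j₁)) e d₁≰e)
  (sym (trans (cong (c₁ ℤ.*_) (ℤP.*-zeroʳ (sign (toℕ j₂)))) (ℤP.*-zeroʳ c₁)))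

-- Weight bounds on supports

module Weights {m : ℕ} (W : Fin m → ℕ) where

  wt : Mon m → ℕ
  wt e = sumℕ (λ i → W i ℕ.* e i)

  wt-cong : ∀ {d e} → d ≗ e → wt d ≡ wt e
  wt-cong d≗e = sumFin-cong ℕ._+_ 0 λ i → cong (W i ℕ.*_) (d≗e i)

  wt-∸ₘ : ∀ {d e} → d ≤ₘ e → wt d + wt (e ∸ₘ d) ≡ wt e
  wt-∸ₘ {d} {e} d≤e = trans (sym (sumℕ-+ (λ i → W i ℕ.* d i) (λ i → W i ℕ.* (e i ∸ d i))))
    (sumFin-cong ℕ._+_ 0 λ i → trans (sym (ℕP.*-distribˡ-+ (W i) (d i) _))
                                     (cong (W i ℕ.*_) (ℕP.m+[n∸m]≡n (d≤e i))))

  SupportedAbove : ℕ → ℕ → Poly m → Set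
  SupportedAbove A B p = ∀ e → wt e + B < A → p e ≡ 0ℤ

  isMonomial-supportedAbove : ∀ {c d p A B} → IsMonomial c d p → (c ≢ 0ℤ → A ≤ wt d + B) →
                              SupportedAbove A B p
  isMonomial-supportedAbove {c} {d} {A = A} {B} p-mon bound e wt<A with e ≗? d
  ... | no  e≭d = off p-mon e e≭d
  ... | yes e≗d with c ℤ.≟ 0ℤ
  ...   | yes c≡0 = trans (at p-mon e e≗d) c≡0
  ...   | no  c≢0 = ⊥-elim (ℕP.<⇒≱ wt<A (subst (λ w → A ≤ w + B) (sym (wt-cong e≗d)) (bound c≢0)))

  *P-supportedAbove : ∀ {A₁ B₁ A₂ B₂ p q} → SupportedAbove A₁ B₁ p → SupportedAbove A₂ B₂ q →
                      SupportedAbove (A₁ + A₂) (B₁ + B₂) (p *P q)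
  *P-supportedAbove {A₁} {B₁} {A₂} {B₂} {p} {q} p-supp q-supp e wt<A = boxSum-zero m e _ vanish
    where
    vanish : ∀ d → d ≤ₘ e → p d ℤ.* q (e ∸ₘ d) ≡ 0ℤ
    vanish d d≤e with A₁ ℕ.≤? wt d + B₁ | A₂ ℕ.≤? wt (e ∸ₘ d) + B₂
    ... | no  A₁≰ | _       = cong (ℤ._* _) (p-supp d (ℕP.≰⇒> A₁≰))
    ... | yes _   | no  A₂≰ = trans (cong (p d ℤ.*_) (q-supp _ (ℕP.≰⇒> A₂≰))) (ℤP.*-zeroʳ (p d))
    ... | yes A₁≤ | yes A₂≤ = ⊥-elim (ℕP.<⇒≱ wt<A (subst (A₁ + A₂ ≤_) split (ℕP.+-mono-≤ A₁≤ A₂≤)))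
      where
      split : wt d + B₁ + (wt (e ∸ₘ d) + B₂) ≡ wt e + (B₁ + B₂)
      split = trans (+-interchange (wt d) B₁ _ B₂) (cong (_+ (B₁ + B₂)) (wt-∸ₘ d≤e))

  det-supportedAbove : ∀ {N} (M : Matrix N) (α β : Fin N → ℕ) →
    (∀ r c → SupportedAbove (α r) (β c) (M r c)) → SupportedAbove (sumℕ α) (sumℕ β) (det M)

  laplaceTerm-supportedAbove : ∀ {N} (M : Matrix (suc N)) (α β : Fin (suc N) → ℕ) →
    (∀ r c → SupportedAbove (α r) (β c) (M r c)) → ∀ {A} j → SupportedAbove A (β j) (M Fin.zero j) →
    SupportedAbove (A + sumℕ (α ∘ Fin.suc)) (sumℕ β) (laplaceTerm M j)

  det-supportedAbove {zero}  M α β M-supp e ()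
  det-supportedAbove {suc N} M α β M-supp e wt<A =
    trans (det-expand M e) (sumFin-zero ℤ._+_ 0ℤ ℤP.+-identity _ λ j →
      trans (cong (sign (toℕ j) ℤ.*_) (laplaceTerm-supportedAbove M α β M-supp j (M-supp Fin.zero j) e wt<A))
            (ℤP.*-zeroʳ (sign (toℕ j))))

  laplaceTerm-supportedAbove M α β M-supp {A} j entry-supp e wt<A =
    *P-supportedAbove entry-supp (det-supportedAbove (minor M j) (α ∘ Fin.suc) (β ∘ punchIn j)
                                    λ r c → M-supp (Fin.suc r) (punchIn j c))
      e (subst (λ b → wt e + b < A + sumℕ (α ∘ Fin.suc)) (sumℕ-punchIn β j) wt<A)

  laplaceTerm-vanishes : ∀ {N} (M : Matrix (suc N)) (α β : Fin (suc N) → ℕ) →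
    (∀ r c → SupportedAbove (α r) (β c) (M r c)) → ∀ e → wt e + sumℕ β ≤ sumℕ α →
    ∀ j → SupportedAbove (suc (α Fin.zero)) (β j) (M Fin.zero j) → laplaceTerm M j e ≡ 0ℤ
  laplaceTerm-vanishes M α β M-supp e tight j strict =
    laplaceTerm-supportedAbove M α β M-supp j strict e (s≤s tight)

  minor-tight : ∀ {N} (α β : Fin (suc N) → ℕ) e d j → wt e + sumℕ β ≤ sumℕ α → d ≤ₘ e →
    α Fin.zero ≤ wt d + β j → wt (e ∸ₘ d) + sumℕ (β ∘ punchIn j) ≤ sumℕ (α ∘ Fin.suc)
  minor-tight α β e d j tight d≤e α₀≤ =
    ℕP.+-cancelˡ-≤ (wt d + β j) _ _ (begin
      wt d + β j + (wt (e ∸ₘ d) + sumℕ (β ∘ punchIn j))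
        ≡⟨ +-interchange (wt d) (β j) _ _ ⟩
      (wt d + wt (e ∸ₘ d)) + (β j + sumℕ (β ∘ punchIn j))
        ≡⟨ cong₂ _+_ (wt-∸ₘ d≤e) (sym (sumℕ-punchIn β j)) ⟩
      wt e + sumℕ β
        ≤⟨ tight ⟩
      α Fin.zero + sumℕ (α ∘ Fin.suc)
        ≤⟨ ℕP.+-monoˡ-≤ _ α₀≤ ⟩
      wt d + β j + sumℕ (α ∘ Fin.suc) ∎)
    where open ℕP.≤-Reasoning

-- The entries of the Jacobian matrix

-- x_{1,i} has coordinates (true , i) and x_{2,i} has (false , i).
Coord : Set
Coord = Bool × ℕ

_≟ᶜ_ : DecidableEquality Coord
_≟ᶜ_ = ≡-dec BoolP._≟_ ℕ._≟_

δ : Coord → Coord → ℕ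
δ u v = if does (u ≟ᶜ v) then 1 else 0

a : ℕ → Bool → ℕ
a R true  = proj₁ (seqA R)
a R false = proj₂ (seqA R)

trExp : ℕ → ℕ → Coord → ℕ
trExp R j (k , i) = if j ≡ᵇ i then a R k else 0

trExp-diag : ∀ R k j → trExp R j (k , j) ≡ a R k
trExp-diag R k j rewrite dec-true (j ℕ.≟ j) refl = refl

trExp-off : ∀ R k {j i} → j ≢ i → trExp R j (k , i) ≡ 0
trExp-off R k {j} {i} j≢i rewrite dec-false (j ℕ.≟ i) j≢i = refl

entryExp : ℕ → Coord → Coord → ℕ
entryExp R v w = trExp R (proj₂ v) w ∸ δ v w

trExp-δ : ∀ R j w → a R true ℕ.* δ (true , j) w + a R false ℕ.* δ (false , j) w ≡ trExp R j w
trExp-δ R j (true , i) with j ≡ᵇ i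
... | true  = trans (cong₂ _+_ (ℕP.*-identityʳ (a R true)) (ℕP.*-zeroʳ (a R false))) (ℕP.+-identityʳ _)
... | false = cong₂ _+_ (ℕP.*-zeroʳ (a R true)) (ℕP.*-zeroʳ (a R false))
trExp-δ R j (false , i) with j ≡ᵇ i
... | true  = cong₂ _+_ (ℕP.*-zeroʳ (a R true)) (ℕP.*-identityʳ (a R false))
... | false = cong₂ _+_ (ℕP.*-zeroʳ (a R true)) (ℕP.*-zeroʳ (a R false))

module JacobianEntries (n : ℕ) where

  Var : Set
  Var = Fin (n + n)

  coord : Var → Coord
  coord t = [ (λ i → true , toℕ i) , (λ i → false , toℕ i) ]′ (Fin.splitAt n t)

  coord-x₁ : ∀ i → coord (x₁ n i) ≡ (true , toℕ i)
  coord-x₁ i rewrite FinP.splitAt-↑ˡ n i n = refl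

  coord-x₂ : ∀ i → coord (x₂ n i) ≡ (false , toℕ i)
  coord-x₂ i rewrite FinP.splitAt-↑ʳ n n i = refl

  coord-injective : ∀ {t u} → coord t ≡ coord u → t ≡ u
  coord-injective {t} {u} t≡u with Fin.splitAt n t in t≡ | Fin.splitAt n u in u≡
  ... | inj₁ i | inj₁ j = trans (sym (FinP.splitAt⁻¹-↑ˡ t≡))
        (trans (cong (Fin._↑ˡ n) (FinP.toℕ-injective (cong proj₂ t≡u))) (FinP.splitAt⁻¹-↑ˡ u≡))
  ... | inj₂ i | inj₂ j = trans (sym (FinP.splitAt⁻¹-↑ʳ t≡))
        (trans (cong (n Fin.↑ʳ_) (FinP.toℕ-injective (cong proj₂ t≡u))) (FinP.splitAt⁻¹-↑ʳ u≡))
  ... | inj₁ i | inj₂ j with () ← cong proj₁ t≡u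
  ... | inj₂ i | inj₁ j with () ← cong proj₁ t≡u

  coord-index : ∀ t → ∃[ J ] proj₂ (coord t) ≡ toℕ {n} J
  coord-index t with Fin.splitAt n t
  ... | inj₁ i = i , refl
  ... | inj₂ i = i , refl

  unitMon-coord : ∀ u t → unitMon u t ≡ δ (coord u) (coord t)
  unitMon-coord u t with u Fin.≟ t
  ... | yes refl = sym (cong (if_then 1 else 0) (dec-true (coord u ≟ᶜ coord u) refl))
  ... | no  u≢t  = sym (cong (if_then 1 else 0) (dec-false (coord u ≟ᶜ coord t) (u≢t ∘ coord-injective)))

  toMon : (Coord → ℕ) → Mon (n + n)
  toMon G t = G (coord t)

  entry : ℕ → Coord → Poly (n + n)
  entry R v = monomial (ℤ.+ a R (proj₁ v)) (toMon (entryExp R v))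

  entry-isMonomial : ∀ R {v} w → v ≡ w → IsMonomial (ℤ.+ a R (proj₁ w)) (toMon (entryExp R w)) (entry R v)
  entry-isMonomial R w refl = monomial-isMonomial _ _

  trTerm-isMonomial : ∀ R i →
    IsMonomial 1ℤ (toMon (trExp R (toℕ i))) ((X (x₁ n i) ^P a R true) *P (X (x₂ n i) ^P a R false))
  trTerm-isMonomial R i = isMonomial-resp refl exp≗ (λ _ → refl)
    (*P-isMonomial (X^P-isMonomial (x₁ n i) (a R true)) (X^P-isMonomial (x₂ n i) (a R false)))
    where
    exp≗ : ∀ t → a R true ℕ.* unitMon (x₁ n i) t + a R false ℕ.* unitMon (x₂ n i) t ≡ trExp R (toℕ i) (coord t)
    exp≗ t rewrite unitMon-coord (x₁ n i) t | unitMon-coord (x₂ n i) t | coord-x₁ i | coord-x₂ i =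
      trExp-δ R (toℕ i) (coord t)

  Jac-entry : ∀ r c → Jac n r c ≗ entry (toℕ r) (coord c)
  Jac-entry r c with coord-index c
  ... | J , j≡J = isMonomial-unique Jac-isMonomial (monomial-isMonomial _ _) coeff≡ exp≗
    where
    R = toℕ r
    k = proj₁ (coord c)
    term : Fin n → Poly (n + n)
    term i = (X (x₁ n i) ^P a R true) *P (X (x₂ n i) ^P a R false)

    Jac-isMonomial : IsMonomial (1ℤ ℤ.* ℤ.+ trExp R (toℕ J) (coord c))
                                (toMon (trExp R (toℕ J)) ∸ₘ unitMon c) (Jac n r c)
    Jac-isMonomial = isMonomial-resp refl (λ _ → refl) (λ e → sym (∂-sumP c term e))
      (sumP-isMonomial _ J (∂-isMonomial c (trTerm-isMonomial R J)) λ i i≢J →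
        isMonomial-zero (isMonomial-resp
          (cong (λ x → 1ℤ ℤ.* ℤ.+ x) (trExp-off R k λ i≡j → i≢J (FinP.toℕ-injective (trans i≡j j≡J))))
          (λ _ → refl) (λ _ → refl) (∂-isMonomial c (trTerm-isMonomial R i))))

    coeff≡ : 1ℤ ℤ.* ℤ.+ trExp R (toℕ J) (coord c) ≡ ℤ.+ a R k
    coeff≡ = trans (ℤP.*-identityˡ _) (cong ℤ.+_ (trans (cong (λ j → trExp R j (coord c)) (sym j≡J))
                                                        (trExp-diag R k (proj₂ (coord c)))))

    exp≗ : toMon (trExp R (toℕ J)) ∸ₘ unitMon c ≗ toMon (entryExp R (coord c))
    exp≗ t = cong₂ _∸_ (cong (λ j → trExp R j (coord t)) (sym j≡J)) (unitMon-coord c t)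

dbl : ℕ → ℕ
dbl zero    = zero
dbl (suc k) = suc (suc (dbl k))

dbl-mono : ∀ {i j} → i ≤ j → dbl i ≤ dbl j
dbl-mono z≤n       = z≤n
dbl-mono (s≤s i≤j) = s≤s (s≤s (dbl-mono i≤j))

dbl≡+ : ∀ k → dbl k ≡ k + k
dbl≡+ zero    = refl
dbl≡+ (suc k) = cong suc (trans (cong suc (dbl≡+ k)) (sym (ℕP.+-suc k k)))

dbl-+ : ∀ i j → dbl (i + j) ≡ dbl i + dbl j
dbl-+ zero    j = refl
dbl-+ (suc i) j = cong (suc ∘ suc) (dbl-+ i j)

⌊dbl/2⌋ : ∀ s → ⌊ dbl s /2⌋ ≡ s
⌊dbl/2⌋ zero    = refl
⌊dbl/2⌋ (suc s) = cong suc (⌊dbl/2⌋ s)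

⌊1+dbl/2⌋ : ∀ s → ⌊ suc (dbl s) /2⌋ ≡ s
⌊1+dbl/2⌋ zero    = refl
⌊1+dbl/2⌋ (suc s) = cong suc (⌊1+dbl/2⌋ s)

dbl⌊/2⌋≤ : ∀ R → dbl ⌊ R /2⌋ ≤ R
dbl⌊/2⌋≤ zero          = z≤n
dbl⌊/2⌋≤ (suc zero)    = z≤n
dbl⌊/2⌋≤ (suc (suc R)) = s≤s (s≤s (dbl⌊/2⌋≤ R))

≤1+dbl⌊/2⌋ : ∀ R → R ≤ suc (dbl ⌊ R /2⌋)
≤1+dbl⌊/2⌋ zero          = z≤n
≤1+dbl⌊/2⌋ (suc zero)    = s≤s z≤n
≤1+dbl⌊/2⌋ (suc (suc R)) = s≤s (s≤s (≤1+dbl⌊/2⌋ R))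

a₂≤ : ∀ R → a R false ≤ R
a₂≤ zero    = z≤n
a₂≤ (suc R) with seqA R | a₂≤ R
... | suc i , j | a₂≤R = s≤s a₂≤R
... | zero  , j | _    = z≤n

1≤deg : ∀ R → 1 ≤ a R true + a R false
1≤deg zero    = s≤s z≤n
1≤deg (suc R) with seqA R
... | suc i , j = subst (1 ≤_) (sym (ℕP.+-suc i j)) (s≤s z≤n)
... | zero  , j = s≤s z≤n

nextPair-independent : ∀ p → 1 ≤ proj₁ p + proj₂ p →
                       proj₁ p ℕ.* proj₂ (nextPair p) ≢ proj₂ p ℕ.* proj₁ (nextPair p)
nextPair-independent (suc i , j) _ i+1*j+1≡j*i = ℕP.<-irrefl (sym i+1*j+1≡j*i) (begin-strict
  j ℕ.* i            ≡⟨ ℕP.*-comm j i ⟩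
  i ℕ.* j            ≤⟨ ℕP.*-monoʳ-≤ i (ℕP.n≤1+n j) ⟩
  i ℕ.* suc j        <⟨ s≤s (ℕP.m≤n+m _ j) ⟩
  suc i ℕ.* suc j    ∎)
  where open ℕP.≤-Reasoning
nextPair-independent (zero , j) 1≤j 0≡j*suc-j with ℕP.m*n≡0⇒m≡0∨n≡0 j (sym 0≡j*suc-j)
... | inj₁ refl = ℕP.<-irrefl refl 1≤j

-- The 2 × 2 minor of rows 2s, 2s+1 in the columns x_{1,s}, x_{2,s} is pairDet s
-- times a monomial.
pairDet : ℕ → ℤ
pairDet s = ℤ.+ a (dbl s) true ℤ.* ℤ.+ a (suc (dbl s)) false ℤ.- ℤ.+ a (dbl s) false ℤ.* ℤ.+ a (suc (dbl s)) true

pairDet≢0 : ∀ s → pairDet s ≢ 0ℤ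
pairDet≢0 s pairDet≡0 = nextPair-independent (seqA (dbl s)) (1≤deg (dbl s))
  (ℤP.+-injective (trans (ℤP.pos-* (a (dbl s) true) (a (suc (dbl s)) false))
    (trans (ℤP.i-j≡0⇒i≡j _ _ pairDet≡0) (sym (ℤP.pos-* (a (dbl s) false) (a (suc (dbl s)) true))))))

-- The j-th term of Tr_{seqA R} has weight κ j · ψ R.
module Potentials (n : ℕ) where

  L : ℕ
  L = dbl n

  κ : ℕ → ℕ
  κ i = n ∸ i

  ψ : ℕ → ℕ
  ψ R = L ℕ.* (a R true + a R false) + a R false

  Wc : Coord → ℕ
  Wc (true  , i) = κ i ℕ.* L
  Wc (false , i) = κ i ℕ.* suc L

  -- gap k exceeds ψ R exactly when R ≤ 2k + 1, which makes Φ R minimal at ⌊ R /2⌋.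
  gap : ℕ → ℕ
  gap k = suc (ψ (suc (dbl k)))

  offset : ℕ → ℕ
  offset zero    = 0
  offset (suc j) = offset j + gap j

  -- wt m + colPot v for the entry m of row R in either column of index j
  Φ : ℕ → ℕ → ℕ
  Φ R j = κ j ℕ.* ψ R + offset j

  rowPot : ℕ → ℕ
  rowPot R = Φ R ⌊ R /2⌋

  colPot : Coord → ℕ
  colPot v = offset (proj₂ v) + Wc v

  ψ-step : ∀ R → suc R < L → ψ R < ψ (suc R)
  ψ-step R 1+R<L with seqA R | a₂≤ R
  ... | suc i , j | _ rewrite ℕP.+-suc i j = ℕP.+-monoʳ-< (L ℕ.* suc (i + j)) (ℕP.n<1+n j)
  ... | zero  , j | j≤R = begin-strict
    L ℕ.* j + j           <⟨ ℕP.+-monoʳ-< (L ℕ.* j) (ℕP.≤-<-trans (ℕP.m≤n⇒m≤1+n j≤R) 1+R<L) ⟩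
    L ℕ.* j + L           ≡⟨ arith L j ⟩
    L ℕ.* (suc j + 0) + 0 ∎
    where
    open ℕP.≤-Reasoning
    arith : ∀ L j → L ℕ.* j + L ≡ L ℕ.* (suc j + 0) + 0
    arith = solve-∀

  ψ-mono-< : ∀ {R R′} → R < R′ → R′ < L → ψ R < ψ R′
  ψ-mono-< {R} {suc R′} (s≤s R≤R′) 1+R′<L with ℕP.m≤n⇒m<n∨m≡n R≤R′
  ... | inj₂ refl  = ψ-step R 1+R′<L
  ... | inj₁ R<R′ = ℕP.<-trans (ψ-mono-< R<R′ (ℕP.<-trans (ℕP.n<1+n R′) 1+R′<L)) (ψ-step R′ 1+R′<L)

  ψ-mono-≤ : ∀ {R R′} → R ≤ R′ → R′ < L → ψ R ≤ ψ R′
  ψ-mono-≤ R≤R′ R′<L with ℕP.m≤n⇒m<n∨m≡n R≤R′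
  ... | inj₁ R<R′ = ℕP.<⇒≤ (ψ-mono-< R<R′ R′<L)
  ... | inj₂ refl  = ℕP.≤-refl

  Φ-step : ∀ R k → suc k ≤ n → Φ R k + gap k ≡ Φ R (suc k) + ψ R
  Φ-step R k 1+k≤n rewrite ℕP.+-∸-assoc 1 1+k≤n =
    arith (κ (suc k)) (ψ R) (offset k) (gap k)
    where
    arith : ∀ x p o g → suc x ℕ.* p + o + g ≡ x ℕ.* p + (o + g) + p
    arith = solve-∀

  Φ-up : ∀ R k → R ≤ suc (dbl k) → suc k ≤ n → Φ R k < Φ R (suc k)
  Φ-up R k R≤ 1+k≤n = ℕP.+-cancelʳ-< _ (Φ R k) (Φ R (suc k))
    (subst (Φ R k + ψ R <_) (Φ-step R k 1+k≤n) (ℕP.+-monoʳ-< (Φ R k) (s≤s (ψ-mono-≤ R≤ (dbl-mono 1+k≤n)))))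

  Φ-down : ∀ R k → dbl (suc k) ≤ R → R < L → suc k ≤ n → Φ R (suc k) ≤ Φ R k
  Φ-down R k ≤R R<L 1+k≤n = ℕP.+-cancelʳ-≤ (ψ R) (Φ R (suc k)) (Φ R k)
    (subst (_≤ Φ R k + ψ R) (Φ-step R k 1+k≤n) (ℕP.+-monoʳ-≤ (Φ R k) (ψ-mono-< ≤R R<L)))

  Φ-up-from : ∀ R i j → i < j → j < n → R ≤ suc (dbl i) → Φ R i < Φ R j
  Φ-up-from R i (suc j) (s≤s i≤j) 1+j<n R≤ with ℕP.m≤n⇒m<n∨m≡n i≤j
  ... | inj₂ refl = Φ-up R i R≤ (ℕP.<⇒≤ 1+j<n)
  ... | inj₁ i<j  = ℕP.<-trans (Φ-up-from R i j i<j (ℕP.<-trans (ℕP.n<1+n j) 1+j<n) R≤)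
    (Φ-up R j (ℕP.≤-trans R≤ (s≤s (dbl-mono (ℕP.<⇒≤ i<j)))) (ℕP.<⇒≤ 1+j<n))

  Φ-down-to : ∀ R i j → j ≤ i → i < n → dbl i ≤ R → R < L → Φ R i ≤ Φ R j
  Φ-down-to R i j j≤i i<n ≤R R<L with ℕP.m≤n⇒m<n∨m≡n j≤i
  ... | inj₂ refl = ℕP.≤-refl
  Φ-down-to R (suc i) j j≤i 1+i<n ≤R R<L | inj₁ (s≤s j≤i′) = ℕP.≤-trans
    (Φ-down R i ≤R R<L (ℕP.<⇒≤ 1+i<n))
    (Φ-down-to R i j j≤i′ (ℕP.<-trans (ℕP.n<1+n i) 1+i<n)
               (ℕP.≤-trans (ℕP.n≤1+n _) (ℕP.≤-trans (ℕP.n≤1+n _) ≤R)) R<L)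

  ⌊/2⌋<n : ∀ R → R < L → ⌊ R /2⌋ < n
  ⌊/2⌋<n R R<L with ⌊ R /2⌋ ℕ.<? n
  ... | yes h<n = h<n
  ... | no  h≮n = ⊥-elim (ℕP.<⇒≱ R<L (ℕP.≤-trans (dbl-mono (ℕP.≮⇒≥ h≮n)) (dbl⌊/2⌋≤ R)))

  rowPot≤Φ : ∀ R j → R < L → j < n → rowPot R ≤ Φ R j
  rowPot≤Φ R j R<L j<n with ℕP.<-cmp ⌊ R /2⌋ j
  ... | tri< h<j _ _ = ℕP.<⇒≤ (Φ-up-from R ⌊ R /2⌋ j h<j j<n (≤1+dbl⌊/2⌋ R))
  ... | tri≈ _ refl _ = ℕP.≤-refl
  ... | tri> _ _ j<h = Φ-down-to R ⌊ R /2⌋ j (ℕP.<⇒≤ j<h) (⌊/2⌋<n R R<L) (dbl⌊/2⌋≤ R) R<L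

  rowPot<Φ : ∀ R j → j < n → ⌊ R /2⌋ < j → rowPot R < Φ R j
  rowPot<Φ R j j<n h<j = Φ-up-from R ⌊ R /2⌋ j h<j j<n (≤1+dbl⌊/2⌋ R)

-- The coefficient of the target monomial

module LeadingTerm (n : ℕ) where

  open JacobianEntries n
  open Potentials n

  W : Var → ℕ
  W t = Wc (coord t)

  open Weights W public

  wtAt : (Coord → ℕ) → ℕ → ℕ
  wtAt G i = Wc (true , i) ℕ.* G (true , i) + Wc (false , i) ℕ.* G (false , i)

  wt-toMon : ∀ G → wt (toMon G) ≡ sumℕ (λ (i : Fin n) → wtAt G (toℕ i))
  wt-toMon G = begin
    wt (toMon G)
      ≡⟨ sumℕ-++ n n (λ t → W t ℕ.* toMon G t) ⟩
    sumℕ {n} (λ i → termWt (coord (x₁ n i)))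
      + sumℕ {n} (λ i → termWt (coord (x₂ n i)))
      ≡⟨ cong₂ _+_ (sumFin-cong ℕ._+_ 0 (cong termWt ∘ coord-x₁))
        (sumFin-cong ℕ._+_ 0 (cong termWt ∘ coord-x₂)) ⟩
    sumℕ {n} (λ i → termWt (true , toℕ i))
      + sumℕ {n} (λ i → termWt (false , toℕ i))
      ≡⟨ sumℕ-+ {n} (λ i → termWt (true , toℕ i)) (λ i → termWt (false , toℕ i)) ⟨
    sumℕ {n} (λ i → wtAt G (toℕ i)) ∎
    where
    open ≡-Reasoning
    termWt : Coord → ℕ
    termWt v = Wc v ℕ.* G v

  wt-toMon-at : ∀ G j → j < n → (∀ k i → i ≢ j → G (k , i) ≡ 0) → wt (toMon G) ≡ wtAt G j
  wt-toMon-at G j j<n G≡0 = trans (wt-toMon G) (trans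
    (sumFin-single ℕ._+_ 0 ℕP.+-identity (λ (i : Fin n) → wtAt G (toℕ i)) (Fin.fromℕ< j<n) λ i i≢ →
       cong₂ _+_ (term≡0 true i (i≢ ∘ toℕ≡j)) (term≡0 false i (i≢ ∘ toℕ≡j)))
    (cong (wtAt G) (FinP.toℕ-fromℕ< j<n)))
    where
    toℕ≡j : ∀ {i} → toℕ i ≡ j → i ≡ Fin.fromℕ< j<n
    toℕ≡j i≡j = FinP.toℕ-injective (trans i≡j (sym (FinP.toℕ-fromℕ< j<n)))
    term≡0 : ∀ k (i : Fin n) → toℕ i ≢ j → Wc (k , toℕ i) ℕ.* G (k , toℕ i) ≡ 0
    term≡0 k i i≢j = trans (cong (Wc (k , toℕ i) ℕ.*_) (G≡0 k (toℕ i) i≢j)) (ℕP.*-zeroʳ (Wc (k , toℕ i)))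

  δ-off : ∀ k′ j k i → i ≢ j → δ (k′ , j) (k , i) ≡ 0
  δ-off k′ j k i i≢j = cong (if_then 1 else 0) (dec-false ((k′ , j) ≟ᶜ (k , i)) (i≢j ∘ sym ∘ cong proj₂))

  wt-δ : ∀ k j → j < n → wt (toMon (δ (k , j))) ≡ Wc (k , j)
  wt-δ k j j<n = trans (wt-toMon-at _ j j<n (δ-off k j)) (wtAt-δ k)
    where
    wtAt-δ : ∀ k → wtAt (δ (k , j)) j ≡ Wc (k , j)
    wtAt-δ true  rewrite dec-true (j ℕ.≟ j) refl =
      trans (cong₂ _+_ (ℕP.*-identityʳ (Wc (true , j))) (ℕP.*-zeroʳ (Wc (false , j)))) (ℕP.+-identityʳ _)
    wtAt-δ false rewrite dec-true (j ℕ.≟ j) refl =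
      cong₂ _+_ (ℕP.*-zeroʳ (Wc (true , j))) (ℕP.*-identityʳ (Wc (false , j)))

  wt-trExp : ∀ R j → j < n → wt (toMon (trExp R j)) ≡ κ j ℕ.* ψ R
  wt-trExp R j j<n = begin
    wt (toMon (trExp R j))
      ≡⟨ wt-toMon-at _ j j<n (λ k i i≢j → trExp-off R k (i≢j ∘ sym)) ⟩
    κ j ℕ.* L ℕ.* trExp R j (true , j) + κ j ℕ.* suc L ℕ.* trExp R j (false , j)
      ≡⟨ cong₂ (λ x y → κ j ℕ.* L ℕ.* x + κ j ℕ.* suc L ℕ.* y)
        (trExp-diag R true j) (trExp-diag R false j) ⟩
    κ j ℕ.* L ℕ.* a R true + κ j ℕ.* suc L ℕ.* a R false
      ≡⟨ arith (κ j) L (a R true) (a R false) ⟩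
    κ j ℕ.* ψ R ∎
    where
    open ≡-Reasoning
    arith : ∀ x L a₁ a₂ → x ℕ.* L ℕ.* a₁ + x ℕ.* suc L ℕ.* a₂ ≡ x ℕ.* (L ℕ.* (a₁ + a₂) + a₂)
    arith = solve-∀

  entry-wt : ∀ R k j → j < n → 1 ≤ a R k → wt (toMon (entryExp R (k , j))) + colPot (k , j) ≡ Φ R j
  entry-wt R k j j<n 1≤a = begin
    wt (toMon (entryExp R (k , j))) + (offset j + Wc (k , j))
      ≡⟨ arith (wt (toMon (entryExp R (k , j)))) (offset j) (Wc (k , j)) ⟩
    Wc (k , j) + wt (toMon (entryExp R (k , j))) + offset j
      ≡⟨ cong₂ (λ x y → x + y + offset j) (sym (wt-δ k j j<n)) refl ⟩
    wt (toMon (δ (k , j))) + wt (toMon (entryExp R (k , j))) + offset j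
      ≡⟨ cong (_+ offset j) (wt-∸ₘ δ≤trExp) ⟩
    wt (toMon (trExp R j)) + offset j
      ≡⟨ cong (_+ offset j) (wt-trExp R j j<n) ⟩
    Φ R j ∎
    where
    open ≡-Reasoning
    arith : ∀ x o w → x + (o + w) ≡ w + x + o
    arith = solve-∀
    δ≤trExp : toMon (δ (k , j)) ≤ₘ toMon (trExp R j)
    δ≤trExp t with (k , j) ≟ᶜ coord t
    ... | yes refl = subst (1 ≤_) (sym (trExp-diag R k j)) 1≤a
    ... | no  _    = z≤n

  entry-supportedAbove : ∀ R v → R < L → proj₂ v < n → SupportedAbove (rowPot R) (colPot v) (entry R v)
  entry-supportedAbove R (k , j) R<L j<n = isMonomial-supportedAbove (entry-isMonomial R (k , j) refl) λ a≢0 →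
    subst (rowPot R ≤_) (sym (entry-wt R k j j<n (+≢0⇒1≤ a≢0))) (rowPot≤Φ R j R<L j<n)

  entry-strict : ∀ R v → proj₂ v < n → ⌊ R /2⌋ < proj₂ v → SupportedAbove (suc (rowPot R)) (colPot v) (entry R v)
  entry-strict R (k , j) j<n h<j = isMonomial-supportedAbove (entry-isMonomial R (k , j) refl) λ a≢0 →
    subst (suc (rowPot R) ≤_) (sym (entry-wt R k j j<n (+≢0⇒1≤ a≢0))) (rowPot<Φ R j j<n h<j)

  -- the x_{k,s}-exponent of the product of the entries of rows 2s, 2s+1 in the
  -- columns x_{1,s}, x_{2,s}
  targetExp : Bool → ℕ → ℕ
  targetExp k s = a (dbl s) k + a (suc (dbl s)) k ∸ 1

  -- exponents of the target monomial E, restricted to the variables of index ≥ s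
  target : ℕ → Coord → ℕ
  target s (k , i) = if s ℕ.≤ᵇ i then targetExp k i else 0

  target-diag : ∀ s k → target s (k , s) ≡ targetExp k s
  target-diag s k rewrite dec-true (s ℕ.≤? s) ℕP.≤-refl = refl

  target-below : ∀ s k i → i < s → target s (k , i) ≡ 0
  target-below s k i i<s rewrite dec-false (s ℕ.≤? i) (ℕP.<⇒≱ i<s) = refl

  target-off : ∀ s k i → i ≢ s → target s (k , i) ≡ target (suc s) (k , i)
  target-off s k i i≢s with s ℕ.≤? i
  ... | yes s≤i rewrite dec-true (s ℕ.≤? i) s≤i | dec-true (suc s ℕ.≤? i) (ℕP.≤∧≢⇒< s≤i (i≢s ∘ sym)) = refl
  ... | no  s≰i rewrite dec-false (s ℕ.≤? i) s≰i | dec-false (suc s ℕ.≤? i) (s≰i ∘ ℕP.<⇒≤) = refl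

  target-n : toMon (target n) ≗ 0ₘ
  target-n t with coord-index t
  ... | J , i≡J = trans (cong (λ i → target n (proj₁ (coord t) , i)) i≡J)
                         (target-below n (proj₁ (coord t)) (toℕ J) (FinP.toℕ<n J))

  wtAt-target : ∀ s i → wtAt (target s) i ≡ (if s ≡ᵇ i then wtAt (target s) s else 0) + wtAt (target (suc s)) i
  wtAt-target s i with s ℕ.≟ i
  ... | yes refl rewrite dec-true (s ℕ.≟ s) refl
                       | target-below (suc s) true s ℕP.≤-refl | target-below (suc s) false s ℕP.≤-refl
                       | ℕP.*-zeroʳ (Wc (true , s)) | ℕP.*-zeroʳ (Wc (false , s)) = sym (ℕP.+-identityʳ _)
  ... | no  s≢i  rewrite dec-false (s ℕ.≟ i) s≢i
                       | target-off s true i (s≢i ∘ sym) | target-off s false i (s≢i ∘ sym) = refl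

  wt-target-step : ∀ s → s < n → wt (toMon (target s)) ≡ wtAt (target s) s + wt (toMon (target (suc s)))
  wt-target-step s s<n = begin
    wt (toMon (target s))
      ≡⟨ wt-toMon (target s) ⟩
    sumℕ (λ (i : Fin n) → wtAt (target s) (toℕ i))
      ≡⟨ sumFin-cong {n} ℕ._+_ 0 (wtAt-target s ∘ toℕ) ⟩
    sumℕ {n} (λ i → diag (toℕ i) + wtAt (target (suc s)) (toℕ i))
      ≡⟨ sumℕ-+ {n} (diag ∘ toℕ) (λ i → wtAt (target (suc s)) (toℕ i)) ⟩
    sumℕ (diag ∘ toℕ {n}) + sumℕ {n} (λ i → wtAt (target (suc s)) (toℕ i))
      ≡⟨ cong₂ _+_ diag-sum (sym (wt-toMon (target (suc s)))) ⟩
    wtAt (target s) s + wt (toMon (target (suc s))) ∎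
    where
    open ≡-Reasoning
    diag : ℕ → ℕ
    diag i = if s ≡ᵇ i then wtAt (target s) s else 0
    diag-sum : sumℕ (diag ∘ toℕ {n}) ≡ wtAt (target s) s
    diag-sum = trans (sumFin-single ℕ._+_ 0 ℕP.+-identity (diag ∘ toℕ) (Fin.fromℕ< s<n) λ i i≢ →
        cong (if_then wtAt (target s) s else 0) (dec-false (s ℕ.≟ toℕ i) λ s≡i →
          i≢ (FinP.toℕ-injective (trans (sym s≡i) (sym (FinP.toℕ-fromℕ< s<n))))))
      (trans (cong diag (FinP.toℕ-fromℕ< s<n)) (cong (if_then wtAt (target s) s else 0) (dec-true (s ℕ.≟ s) refl)))

  1+targetExp : ∀ k s → suc (targetExp k s) ≡ a (dbl s) k + a (suc (dbl s)) k
  1+targetExp k s = trans (ℕP.+-comm 1 _) (ℕP.m∸n+n≡m (1≤pair k))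
    where
    1≤pair : ∀ k → 1 ≤ a (dbl s) k + a (suc (dbl s)) k
    1≤pair true with seqA (dbl s)
    ... | suc i , j = s≤s z≤n
    ... | zero  , j = s≤s z≤n
    1≤pair false with seqA (dbl s) | 1≤deg (dbl s)
    ... | suc i , j | _     = subst (1 ≤_) (sym (ℕP.+-suc j j)) (s≤s z≤n)
    ... | zero  , j | 1≤j+0 = subst (1 ≤_) (sym (ℕP.+-identityʳ j)) 1≤j+0

  target-pair-tight : ∀ s → wtAt (target s) s + colPot (true , s) + colPot (false , s)
                            ≡ rowPot (dbl s) + rowPot (suc (dbl s))
  target-pair-tight s rewrite target-diag s true | target-diag s false | ⌊dbl/2⌋ s | ⌊1+dbl/2⌋ s = begin
    κ s ℕ.* L ℕ.* targetExp true s + κ s ℕ.* suc L ℕ.* targetExp false s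
      + (offset s + κ s ℕ.* L) + (offset s + κ s ℕ.* suc L)
      ≡⟨ arith₁ (κ s) L (targetExp true s) (targetExp false s) (offset s) ⟩
    κ s ℕ.* (L ℕ.* (suc (targetExp true s) + suc (targetExp false s)) + suc (targetExp false s)) + (offset s + offset s)
      ≡⟨ cong₂ (λ x y → κ s ℕ.* (L ℕ.* (x + y) + y) + (offset s + offset s))
        (1+targetExp true s) (1+targetExp false s) ⟩
    κ s ℕ.* (L ℕ.* ((a₁ + a₁′) + (a₂ + a₂′)) + (a₂ + a₂′)) + (offset s + offset s)
      ≡⟨ arith₂ (κ s) L a₁ a₂ a₁′ a₂′ (offset s) ⟩
    κ s ℕ.* ψ (dbl s) + offset s + (κ s ℕ.* ψ (suc (dbl s)) + offset s) ∎
    where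
    open ≡-Reasoning
    a₁ = a (dbl s) true
    a₂ = a (dbl s) false
    a₁′ = a (suc (dbl s)) true
    a₂′ = a (suc (dbl s)) false
    arith₁ : ∀ x L e₁ e₂ o → x ℕ.* L ℕ.* e₁ + x ℕ.* suc L ℕ.* e₂ + (o + x ℕ.* L) + (o + x ℕ.* suc L)
                             ≡ x ℕ.* (L ℕ.* (suc e₁ + suc e₂) + suc e₂) + (o + o)
    arith₁ = solve-∀
    arith₂ : ∀ x L a₁ a₂ a₁′ a₂′ o →
             x ℕ.* (L ℕ.* ((a₁ + a₁′) + (a₂ + a₂′)) + (a₂ + a₂′)) + (o + o)
               ≡ x ℕ.* (L ℕ.* (a₁ + a₂) + a₂) + o + (x ℕ.* (L ℕ.* (a₁′ + a₂′) + a₂′) + o)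
    arith₂ = solve-∀

  -- The submatrix on rows 2s, …, 2s + 2k − 1 and columns x_{1,s}, …, x_{1,s+k−1},
  -- x_{2,s}, …, x_{2,s+k−1}; for s = 0, k = n it is the whole Jacobian matrix.
  col : ℕ → (k : ℕ) → Fin (dbl k) → Coord
  col s k c = if toℕ c ℕ.<ᵇ k then (true , toℕ c + s) else (false , (toℕ c ∸ k) + s)

  row : ℕ → ∀ {N} → Fin N → ℕ
  row s r = toℕ r + dbl s

  S : ℕ → (k : ℕ) → Fin (dbl k) → Fin (dbl k) → Poly (n + n)
  S s k r c = entry (row s r) (col s k c)

  col-< : ∀ s k c → toℕ c < k → col s k c ≡ (true , toℕ c + s)
  col-< s k c c<k rewrite dec-true (toℕ c ℕ.<? k) c<k = refl

  col-≥ : ∀ s k c → k ≤ toℕ c → col s k c ≡ (false , (toℕ c ∸ k) + s)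
  col-≥ s k c k≤c rewrite dec-false (toℕ c ℕ.<? k) (ℕP.≤⇒≯ k≤c) = refl

  col-index< : ∀ s k → s + k ≡ n → ∀ c → proj₂ (col s k c) < n
  col-index< s k s+k≡n c with toℕ c ℕ.<? k
  ... | yes c<k rewrite col-< s k c c<k = subst (toℕ c + s <_) (trans (ℕP.+-comm k s) s+k≡n) (ℕP.+-monoˡ-< s c<k)
  ... | no  c≮k rewrite col-≥ s k c (ℕP.≮⇒≥ c≮k) =
    subst ((toℕ c ∸ k) + s <_) (trans (ℕP.+-comm k s) s+k≡n) (ℕP.+-monoˡ-< s
      (ℕP.+-cancelʳ-< k _ _ (subst₂ _<_ (sym (ℕP.m∸n+n≡m (ℕP.≮⇒≥ c≮k))) (dbl≡+ k) (FinP.toℕ<n c))))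

  col-index≥ : ∀ s k c → s ≤ proj₂ (col s k c)
  col-index≥ s k c with toℕ c ℕ.<? k
  ... | yes c<k rewrite col-< s k c c<k = ℕP.m≤n+m s (toℕ c)
  ... | no  c≮k rewrite col-≥ s k c (ℕP.≮⇒≥ c≮k) = ℕP.m≤n+m s _

  col-index≡ : ∀ s k c → proj₂ (col s k c) ≡ s → toℕ c ≡ 0 ⊎ toℕ c ≡ k
  col-index≡ s k c i≡s with toℕ c ℕ.<? k
  ... | yes c<k rewrite col-< s k c c<k = inj₁ (ℕP.+-cancelʳ-≡ s (toℕ c) 0 i≡s)
  ... | no  c≮k rewrite col-≥ s k c (ℕP.≮⇒≥ c≮k) =
    inj₂ (ℕP.≤-antisym (ℕP.m∸n≡0⇒m≤n (ℕP.+-cancelʳ-≡ s (toℕ c ∸ k) 0 i≡s)) (ℕP.≮⇒≥ c≮k))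

  row< : ∀ s k → s + k ≡ n → ∀ (r : Fin (dbl k)) → row s r < L
  row< s k s+k≡n r = subst (row s r <_) (trans (sym (dbl-+ k s)) (cong dbl (trans (ℕP.+-comm k s) s+k≡n)))
                           (ℕP.+-monoˡ-< (dbl s) (FinP.toℕ<n r))

  S-supportedAbove : ∀ s k → s + k ≡ n → ∀ r c →
    SupportedAbove (rowPot (row s r)) (colPot (col s k c)) (S s k r c)
  S-supportedAbove s k s+k≡n r c = entry-supportedAbove (row s r) (col s k c) (row< s k s+k≡n r) (col-index< s k s+k≡n c)

  S-congruent : ∀ s k r c → Congruent _≗_ _≡_ (S s k r c)
  S-congruent s k r c = isMonomial-congruent (entry-isMonomial (row s r) (col s k c) refl)

  -- The column x_{2,s} of S s (suc k) is Fin.suc (y-col k).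
  y-col : ∀ k → Fin (suc (dbl k))
  y-col k = Fin.fromℕ< (s≤s (subst (k ≤_) (sym (dbl≡+ k)) (ℕP.m≤m+n k k)))

  toℕ-y-col : ∀ k → toℕ (y-col k) ≡ k
  toℕ-y-col k = FinP.toℕ-fromℕ< _

  col-y : ∀ s k → col s (suc k) (Fin.suc (y-col k)) ≡ (false , s)
  col-y s k = trans (col-≥ s (suc k) (Fin.suc (y-col k)) (ℕP.≤-reflexive (cong suc (sym (toℕ-y-col k)))))
                    (cong (λ x → (false , x + s)) (trans (cong (_∸ k) (toℕ-y-col k)) (ℕP.n∸n≡0 k)))

  col-minor : ∀ s k (c : Fin (dbl k)) → col s (suc k) (Fin.suc (punchIn (y-col k) c)) ≡ col (suc s) k c
  col-minor s k c with toℕ c ℕ.<? k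
  ... | yes c<k = begin
    col s (suc k) (Fin.suc (punchIn (y-col k) c))
      ≡⟨ col-< s (suc k) _ (subst (_< suc k) (cong suc (sym toℕ≡)) (s≤s c<k)) ⟩
    (true , suc (toℕ (punchIn (y-col k) c)) + s)
      ≡⟨ cong (λ x → (true , suc x + s)) toℕ≡ ⟩
    (true , suc (toℕ c) + s)
      ≡⟨ cong (true ,_) (ℕP.+-suc (toℕ c) s) ⟨
    (true , toℕ c + suc s)
      ≡⟨ col-< (suc s) k c c<k ⟨
    col (suc s) k c ∎
    where
    open ≡-Reasoning
    toℕ≡ = toℕ-punchIn-< (y-col k) c (subst (toℕ c <_) (sym (toℕ-y-col k)) c<k)
  ... | no  c≮k = begin
    col s (suc k) (Fin.suc (punchIn (y-col k) c))
      ≡⟨ col-≥ s (suc k) _ (subst (suc k ≤_) (cong suc (sym toℕ≡)) (s≤s (ℕP.m≤n⇒m≤1+n k≤c))) ⟩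
    (false , (suc (toℕ (punchIn (y-col k) c)) ∸ suc k) + s)
      ≡⟨ cong (λ x → (false , (suc x ∸ suc k) + s)) toℕ≡ ⟩
    (false , (suc (toℕ c) ∸ k) + s)
      ≡⟨ cong (λ x → (false , x + s)) (ℕP.+-∸-assoc 1 k≤c) ⟩
    (false , suc (toℕ c ∸ k) + s)
      ≡⟨ cong (false ,_) (ℕP.+-suc (toℕ c ∸ k) s) ⟨
    (false , (toℕ c ∸ k) + suc s)
      ≡⟨ col-≥ (suc s) k c k≤c ⟨
    col (suc s) k c ∎
    where
    open ≡-Reasoning
    k≤c = ℕP.≮⇒≥ c≮k
    toℕ≡ = toℕ-punchIn-≥ (y-col k) c (subst (_≤ toℕ c) (sym (toℕ-y-col k)) k≤c)

  row-suc-suc : ∀ s {N} (r : Fin N) → row s (Fin.suc (Fin.suc r)) ≡ row (suc s) r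
  row-suc-suc s r = sym (trans (ℕP.+-suc (toℕ r) _) (cong suc (ℕP.+-suc (toℕ r) _)))

  S-minor : ∀ s k r c → S s (suc k) (Fin.suc (Fin.suc r)) (Fin.suc (punchIn (y-col k) c)) ≗ S (suc s) k r c
  S-minor s k r c e = cong₂ (λ R v → entry R v e) (row-suc-suc s r) (col-minor s k c)

  target-tight : ∀ s k → s + k ≡ n →
    wt (toMon (target s)) + sumℕ (colPot ∘ col s k) ≡ sumℕ (rowPot ∘ row s {dbl k})
  target-tight s zero s+0≡n = begin
    wt (toMon (target s)) + 0
      ≡⟨ ℕP.+-identityʳ _ ⟩
    wt (toMon (target s))
      ≡⟨ cong (wt ∘ toMon ∘ target) (trans (sym (ℕP.+-identityʳ s)) s+0≡n) ⟩
    wt (toMon (target n))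
      ≡⟨ wt-cong target-n ⟩
    wt 0ₘ
      ≡⟨ sumFin-zero ℕ._+_ 0 ℕP.+-identity _ (ℕP.*-zeroʳ ∘ W) ⟩
    0 ∎
    where open ≡-Reasoning
  target-tight s (suc k) s+1+k≡n = begin
    wt (toMon (target s)) + sumℕ (colPot ∘ col s (suc k))
      ≡⟨ cong₂ _+_ (wt-target-step s s<n) colPot-sum ⟩
    (w₀ + wt (toMon (target (suc s)))) + (colPot x + (colPot y + sumℕ (colPot ∘ col (suc s) k)))
      ≡⟨ arith w₀ _ (colPot x) (colPot y) _ ⟩
    (w₀ + colPot x + colPot y) + (wt (toMon (target (suc s))) + sumℕ (colPot ∘ col (suc s) k))
      ≡⟨ cong₂ _+_ (target-pair-tight s) (target-tight (suc s) k (trans (sym (ℕP.+-suc s k)) s+1+k≡n)) ⟩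
    (rowPot (dbl s) + rowPot (suc (dbl s))) + sumℕ (rowPot ∘ row (suc s) {dbl k})
      ≡⟨ ℕP.+-assoc (rowPot (dbl s)) _ _ ⟩
    rowPot (dbl s) + (rowPot (suc (dbl s)) + sumℕ (rowPot ∘ row (suc s) {dbl k}))
      ≡⟨ cong (λ x → rowPot (dbl s) + (rowPot (suc (dbl s)) + x))
              (sumFin-cong {dbl k} ℕ._+_ 0 (cong rowPot ∘ row-suc-suc s)) ⟨
    sumℕ (rowPot ∘ row s {dbl (suc k)}) ∎
    where
    open ≡-Reasoning
    w₀ = wtAt (target s) s
    x = (true , s)
    y = (false , s)
    s<n : s < n
    s<n = subst (s <_) s+1+k≡n (ℕP.m<m+n s (s≤s z≤n))
    arith : ∀ p w x y c → (p + w) + (x + (y + c)) ≡ (p + x + y) + (w + c)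
    arith = solve-∀
    colPot-sum : sumℕ (colPot ∘ col s (suc k)) ≡ colPot x + (colPot y + sumℕ (colPot ∘ col (suc s) k))
    colPot-sum = cong (colPot x +_)
      (trans (sumℕ-punchIn (colPot ∘ col s (suc k) ∘ Fin.suc) (y-col k))
        (cong₂ _+_ (cong colPot (col-y s k)) (sumFin-cong ℕ._+_ 0 (cong colPot ∘ col-minor s k))))

  target-peel : ∀ s k → 1 ≤ a (dbl s) k → 1 ≤ a (suc (dbl s)) (not k) → ∀ w →
    target s w ≡ entryExp (dbl s) (k , s) w + (entryExp (suc (dbl s)) (not k , s) w + target (suc s) w)
  target-peel s k 1≤a 1≤a′ (b , i) with s ℕ.≟ i
  ... | no  s≢i rewrite trExp-off (dbl s) b s≢i | trExp-off (suc (dbl s)) b s≢i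
                      | ℕP.0∸n≡0 (δ (k , s) (b , i)) | ℕP.0∸n≡0 (δ (not k , s) (b , i))
                      = target-off s b i (s≢i ∘ sym)
  ... | yes refl rewrite target-diag s b | target-below (suc s) b s ℕP.≤-refl
                       | trExp-diag (dbl s) b s | trExp-diag (suc (dbl s)) b s = cases k b 1≤a 1≤a′
    where
    ∸1-left : ∀ {x} y → 1 ≤ x → x + y ∸ 1 ≡ (x ∸ 1) + (y + 0)
    ∸1-left {suc x} y _ = cong (x +_) (sym (ℕP.+-identityʳ y))
    ∸1-right : ∀ x {y} → 1 ≤ y → x + y ∸ 1 ≡ x + ((y ∸ 1) + 0)
    ∸1-right x {suc y} _ rewrite ℕP.+-suc x y = cong (x +_) (sym (ℕP.+-identityʳ y))
    cases : ∀ k b → 1 ≤ a (dbl s) k → 1 ≤ a (suc (dbl s)) (not k) →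
      a (dbl s) b + a (suc (dbl s)) b ∸ 1
        ≡ a (dbl s) b ∸ δ (k , s) (b , s) + (a (suc (dbl s)) b ∸ δ (not k , s) (b , s) + 0)
    cases true  true  1≤a _    rewrite dec-true (s ℕ.≟ s) refl = ∸1-left _ 1≤a
    cases true  false _   1≤a′ rewrite dec-true (s ℕ.≟ s) refl = ∸1-right (a (dbl s) false) 1≤a′
    cases false true  _   1≤a′ rewrite dec-true (s ℕ.≟ s) refl = ∸1-right (a (dbl s) true) 1≤a′
    cases false false 1≤a _    rewrite dec-true (s ℕ.≟ s) refl = ∸1-left _ 1≤a

  module Step (s k : ℕ) (s+1+k≡n : s + suc k ≡ n) where

    M : Fin (dbl (suc k)) → Fin (dbl (suc k)) → Poly (n + n)
    M = S s (suc k)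

    e : Mon (n + n)
    e = toMon (target s)

    Y : ℤ
    Y = det (S (suc s) k) (toMon (target (suc s)))

    p : Fin (suc (dbl k))
    p = y-col k

    α β : Fin (dbl (suc k)) → ℕ
    α = rowPot ∘ row s
    β = colPot ∘ col s (suc k)

    s<n : s < n
    s<n = subst (s <_) s+1+k≡n (ℕP.m<m+n s (s≤s z≤n))

    M-supp : ∀ r c → SupportedAbove (α r) (β c) (M r c)
    M-supp = S-supportedAbove s (suc k) s+1+k≡n

    tight : wt e + sumℕ β ≤ sumℕ α
    tight = ℕP.≤-reflexive (target-tight s (suc k) s+1+k≡n)

    strict : ∀ R → ⌊ R /2⌋ ≡ s → ∀ c → proj₂ (col s (suc k) c) ≢ s →
             SupportedAbove (suc (rowPot R)) (β c) (entry R (col s (suc k) c))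
    strict R ⌊R/2⌋≡s c i≢s = entry-strict R (col s (suc k) c) (col-index< s (suc k) s+1+k≡n c)
      (subst (_< proj₂ (col s (suc k) c)) (sym ⌊R/2⌋≡s) (ℕP.≤∧≢⇒< (col-index≥ s (suc k) c) (i≢s ∘ sym)))

    index≡s : ∀ c → proj₂ (col s (suc k) c) ≡ s → c ≡ Fin.zero ⊎ c ≡ Fin.suc p
    index≡s c i≡s with col-index≡ s (suc k) c i≡s
    ... | inj₁ c≡0   = inj₁ (FinP.toℕ-injective c≡0)
    ... | inj₂ c≡1+k = inj₂ (FinP.toℕ-injective (trans c≡1+k (cong suc (sym (toℕ-y-col k)))))

    row₀-others : ∀ j → j ≢ Fin.zero → j ≢ Fin.suc p → laplaceTerm M j e ≡ 0ℤ
    row₀-others j j≢0 j≢p = laplaceTerm-vanishes M α β M-supp e tight j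
      (strict (dbl s) (⌊dbl/2⌋ s) j λ i≡s → [ j≢0 , j≢p ]′ (index≡s j i≡s))

    -- Row 2s takes the column j₁ of x_{k₁,s}, row 2s+1 the column of x_{not k₁,s}.
    route : ∀ k₁ j₁ j₂ → col s (suc k) j₁ ≡ (k₁ , s) → col s (suc k) (punchIn j₁ j₂) ≡ (not k₁ , s) →
      (∀ c → c ≡ Fin.zero ⊎ c ≡ Fin.suc p → c ≡ j₁ ⊎ c ≡ punchIn j₁ j₂) →
      (∀ c → punchIn j₁ (punchIn j₂ c) ≡ Fin.suc (punchIn p c)) →
      laplaceTerm M j₁ e ≡ ℤ.+ a (dbl s) k₁ ℤ.* (sign (toℕ j₂) ℤ.* (ℤ.+ a (suc (dbl s)) (not k₁) ℤ.* Y))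
    route k₁ j₁ j₂ col₁ col₂ tight-cols minor-cols =
      laplaceTerm-twoStep M j₁ j₂ e Y (entry-isMonomial (dbl s) (k₁ , s) col₁)
        (entry-isMonomial (suc (dbl s)) (not k₁ , s) col₂) (S-congruent s (suc k)) others inner
      where
      d₁ d₂ : Mon (n + n)
      d₁ = toMon (entryExp (dbl s) (k₁ , s))
      d₂ = toMon (entryExp (suc (dbl s)) (not k₁ , s))

      others : ℤ.+ a (dbl s) k₁ ≢ 0ℤ → d₁ ≤ₘ e →
               ∀ j → j ≢ j₂ → laplaceTerm (minor M j₁) j (e ∸ₘ d₁) ≡ 0ℤ
      others a≢0 d₁≤e j j≢j₂ = laplaceTerm-vanishes (minor M j₁) (α ∘ Fin.suc) (β ∘ punchIn j₁)
        (λ r c → M-supp (Fin.suc r) (punchIn j₁ c)) (e ∸ₘ d₁)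
        (minor-tight α β e d₁ j₁ tight d₁≤e row₀-tight) j
        (strict (suc (dbl s)) (⌊1+dbl/2⌋ s) (punchIn j₁ j) λ i≡s →
           [ FinP.punchInᵢ≢i j₁ j , j≢j₂ ∘ FinP.punchIn-injective j₁ j j₂ ]′ (tight-cols _ (index≡s _ i≡s)))
        where
        row₀-tight : α Fin.zero ≤ wt d₁ + β j₁
        row₀-tight rewrite col₁ = ℕP.≤-reflexive (trans (cong (Φ (dbl s)) (⌊dbl/2⌋ s))
                                                         (sym (entry-wt (dbl s) k₁ s s<n (+≢0⇒1≤ a≢0))))

      inner : ℤ.+ a (dbl s) k₁ ≢ 0ℤ → ℤ.+ a (suc (dbl s)) (not k₁) ≢ 0ℤ →
              d₁ ≤ₘ e × d₂ ≤ₘ e ∸ₘ d₁ × det (minor (minor M j₁) j₂) ((e ∸ₘ d₁) ∸ₘ d₂) ≡ Y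
      inner a≢0 a′≢0 with ≗+ₘ-peel (target-peel s k₁ (+≢0⇒1≤ a≢0) (+≢0⇒1≤ a′≢0) ∘ coord)
      ... | d₁≤e , d₂≤ , rest≗ = d₁≤e , d₂≤ ,
        trans (det-cong (λ r c f → trans (cong (λ c′ → M (Fin.suc (Fin.suc r)) c′ f) (minor-cols c))
                                         (S-minor s k r c f)) _)
              (det-congruent (S (suc s) k) (S-congruent (suc s) k) rest≗)

    route₁ : laplaceTerm M Fin.zero e
               ≡ ℤ.+ a (dbl s) true ℤ.* (sign (toℕ p) ℤ.* (ℤ.+ a (suc (dbl s)) false ℤ.* Y))
    route₁ = route true Fin.zero p refl (col-y s k) (λ _ c≡ → c≡) (λ _ → refl)

    route₂ : laplaceTerm M (Fin.suc p) e
               ≡ ℤ.+ a (dbl s) false ℤ.* (sign 0 ℤ.* (ℤ.+ a (suc (dbl s)) true ℤ.* Y))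
    route₂ = route false (Fin.suc p) Fin.zero (col-y s k) refl (λ _ → [ inj₂ , inj₁ ]′) (λ _ → refl)

    det-step : det M e ≡ sign (toℕ p) ℤ.* (pairDet s ℤ.* Y)
    det-step = begin
      det M e
        ≡⟨ det-two-terms M e p row₀-others ⟩
      laplaceTerm M Fin.zero e ℤ.+ sign (suc (toℕ p)) ℤ.* laplaceTerm M (Fin.suc p) e
        ≡⟨ cong₂ ℤ._+_ route₁ (cong₂ ℤ._*_ (sign-suc (toℕ p)) route₂) ⟩
      x₀ ℤ.* (σ ℤ.* (y₁ ℤ.* Y)) ℤ.+ (- σ) ℤ.* (y₀ ℤ.* (1ℤ ℤ.* (x₁′ ℤ.* Y)))
        ≡⟨ ring x₀ y₁ y₀ x₁′ σ Y ⟩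
      σ ℤ.* (pairDet s ℤ.* Y) ∎
      where
      open ≡-Reasoning
      σ = sign (toℕ p)
      x₀ = ℤ.+ a (dbl s) true
      y₀ = ℤ.+ a (dbl s) false
      x₁′ = ℤ.+ a (suc (dbl s)) true
      y₁ = ℤ.+ a (suc (dbl s)) false
      ring : ∀ x₀ y₁ y₀ x₁ σ Y →
             x₀ ℤ.* (σ ℤ.* (y₁ ℤ.* Y)) ℤ.+ (- σ) ℤ.* (y₀ ℤ.* (ℤ.+ 1 ℤ.* (x₁ ℤ.* Y)))
               ≡ σ ℤ.* ((x₀ ℤ.* y₁ ℤ.- y₀ ℤ.* x₁) ℤ.* Y)
      ring = ℤSolver.solve-∀

  det-S-target : ∀ k s → s + k ≡ n → det (S s k) (toMon (target s)) ≢ 0ℤ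
  det-S-target zero s s+0≡n det≡0 = 1≢0 (trans (sym (at 1P-isMonomial _ target≗0)) det≡0)
    where
    1≢0 : 1ℤ ≢ 0ℤ
    1≢0 ()
    target≗0 : toMon (target s) ≗ 0ₘ
    target≗0 t = trans (cong (λ s′ → toMon (target s′) t) (trans (sym (ℕP.+-identityʳ s)) s+0≡n)) (target-n t)
  det-S-target (suc k) s s+1+k≡n det≡0 =
    i*j≢0 (sign≢0 (toℕ (y-col k)))
          (i*j≢0 (pairDet≢0 s) (det-S-target k (suc s) (trans (sym (ℕP.+-suc s k)) s+1+k≡n)))
      (trans (sym (Step.det-step s k s+1+k≡n)) det≡0)

  coord≡col : ∀ (c : Fin (dbl n)) t → toℕ t ≡ toℕ c → coord t ≡ col 0 n c
  coord≡col c t t≡c with Fin.splitAt n t in split≡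
  ... | inj₁ i = sym (trans (col-< 0 n c c<n) (cong (true ,_) (trans (ℕP.+-identityʳ _) (sym i≡c))))
    where
    i≡c : toℕ i ≡ toℕ c
    i≡c = trans (sym (FinP.toℕ-↑ˡ i n)) (trans (cong toℕ (FinP.splitAt⁻¹-↑ˡ split≡)) t≡c)
    c<n : toℕ c < n
    c<n = subst (_< n) i≡c (FinP.toℕ<n i)
  ... | inj₂ i = sym (trans (col-≥ 0 n c n≤c) (cong (false ,_) (trans (ℕP.+-identityʳ _) c∸n≡i)))
    where
    n+i≡c : n + toℕ i ≡ toℕ c
    n+i≡c = trans (sym (FinP.toℕ-↑ʳ n i)) (trans (cong toℕ (FinP.splitAt⁻¹-↑ʳ split≡)) t≡c)
    n≤c : n ≤ toℕ c
    n≤c = subst (n ≤_) n+i≡c (ℕP.m≤m+n n (toℕ i))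
    c∸n≡i : toℕ c ∸ n ≡ toℕ i
    c∸n≡i = trans (cong (_∸ n) (sym n+i≡c)) (ℕP.m+n∸m≡n n (toℕ i))

  det-Jac≗det-S : det (Jac n) ≗ det (S 0 n)
  det-Jac≗det-S e = trans (det-cast (sym (dbl≡+ n)) (Jac n) e) (det-cong (λ r c f →
    trans (Jac-entry _ _ f) (cong₂ (λ R v → entry R v f)
      (trans (FinP.toℕ-cast _ r) (sym (ℕP.+-identityʳ _))) (coord≡col c _ (FinP.toℕ-cast _ c)))) e)

lemma3p1 : (n : ℕ) → 1 ≤ n → ∃ λ (e : Mon (n + n)) → det (Jac n) e ≢ 0ℤ
lemma3p1 n _ = toMon (target 0) , λ det≡0 →
  det-S-target n 0 refl (trans (sym (det-Jac≗det-S (toMon (target 0)))) det≡0)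
  where
  open JacobianEntries n
  open LeadingTerm n
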